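{- Let $p<q$ be prime numbers, let $\mathcal{A}=\{ -1,0,1\}$, let $s=\lfloor q/p\rfloor$ and $r=q \bmod p$. Define $\boldsymbol{d}_0=1\,(-1)\,0\cdots 0\in\mathcal{A}^p$ (a $1$, then a $-1$, then $p-2$ zeros), and $\boldsymbol{d}_i=\sigma^{q}(\boldsymbol{d}_{i-1})=\sigma^{iq}(\boldsymbol{d}_0)$ for $i\ge 1$. Define $\boldsymbol{\omega}_0=\boldsymbol{d}_0$ and $\boldsymbol{\omega}_i=\boldsymbol{\omega}_{i-1}+\boldsymbol{d}_i$ for $1\le i\le p-2$ (coordinatewise integer addition). Then: 1. The words $\boldsymbol{\omega}_0,\dots,\boldsymbol{\omega}_{p-2}$ belong to $\mathcal{A}^p$, i.e. each addition $\boldsymbol{\omega}_{i-1}+\boldsymbol{d}_i$ never produces $1+1$ or $(-1)+(-1)$ in any coordinate. These $p-1$ words depend only on the pair $(p,r)$. 2. The cyclotomic word $\boldsymbol{a}_{pq}$ coincides with the prefix of length $\varphi(pq)+1$ of the word $$\boldsymbol{b}_{pq}=\boldsymbol{\omega}_0^s\cdot\boldsymbol{\omega}_0^{r/p}\cdot\boldsymbol{\omega}_1^s\cdot\boldsymbol{\omega}_1^{r/p}\cdots\boldsymbol{\omega}_{p-2}^s\cdot\boldsymbol{\omega}_{p-2}^{r/p}\in\mathcal{A}^{(p-1)q},$$ and in fractional power notation $$\boldsymbol{a}_{pq}=\boldsymbol{\omega}_0^{q/p}\cdot\boldsymbol{\omega}_1^{q/p}\cdots\boldsymbol{\omega}_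{p-3}^{q/p}\cdot\boldsymbol{\omega}_{p-2}^{(q-p+2)/p}.$$
   Context: For coprime $n$, $\Phi_n$ denotes the $n$-th cyclotomic polynomial; for distinct primes $p,q$, $\Phi_{pq}$ has degree $m=\varphi(pq)=(p-1)(q-1)$ and integer coefficients. The cyclotomic word $\boldsymbol{a}_{pq}=a_0a_1\cdots a_m$ is the sequence of coefficients of $\Phi_{pq}(x)=\sum_{i=0}^m a_ix^i$, viewed as a word. Words are finite sequences over $\mathcal{A}$; $\boldsymbol{u}\cdot\boldsymbol{v}$ is concatenation, $\boldsymbol{v}^s$ is the $s$-fold concatenation ($\boldsymbol{v}^0$ is the empty word). For $\boldsymbol{v}\in\mathcal{A}^p$ and an integer $k\ge 0$, the fractional power $\boldsymbol{v}^{k/p}\in\mathcal{A}^k$ is: the prefix of $\boldsymbol{v}$ of length $k$ if $k<p$, and $\boldsymbol{v}^{\lfloor k/p\rfloor}\cdot\boldsymbol{v}^{(k\bmod p)/p}$ if $k\ge p$. The left circular permutation $\sigma:\mathcal{A}^p\to\mathcal{A}^p$ is $\sigma(v_0v_1\cdots v_{p-1})=v_1\cdots v_{p-1}v_0$, so $\sigma^p=\mathrm{Id}$. The sum of two words of equal length is the coordinatewise sum in $\mathbb{Z}$. -}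

module Defs where

open import Data.Nat as ℕ using (ℕ; zero; suc; _∸_; NonZero)
open import Data.Nat.DivMod using (_/_; _%_)
open import Data.Nat.Divisibility using (_∣?_)
open import Data.Integer as ℤ using (ℤ; +_; -[1+_])
open import Data.List using (List; []; _∷_; _++_; map; replicate; take; concat; concatMap; reverse; length; zipWith; filter; upTo; foldr; drop)
open import Data.List.Relation.Unary.All using (All)
open import Data.Product using (_×_)
open import Data.Sum using (_⊎_)
open import Function using (_∘_)
open import Relation.Binary.PropositionalEquality using (_≡_)

-- Integer polynomials as coefficient lists, lowest degree first.

padd : List ℤ → List ℤ → List ℤ
padd [] g = g
padd f [] = f
padd (a ∷ f) (b ∷ g) = (a ℤ.+ b) ∷ padd f g

pmul : List ℤ → List ℤ → List ℤ
pmul [] g = []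
pmul (a ∷ f) g = padd (map (a ℤ.*_) g) (+ 0 ∷ pmul f g)

pprod : List (List ℤ) → List ℤ
pprod = foldr pmul (+ 1 ∷ [])

xn-1 : ℕ → List ℤ
-- (used for n ≥ 1, where the list has length n + 1)
xn-1 n = -[1+ 0 ] ∷ replicate (ℕ.pred n) (+ 0) ++ (+ 1 ∷ [])

-- Long division by a monic polynomial, on coefficient lists written
-- highest degree first.  `subScaled r c t` computes r - c·t on the leading
-- positions of r.
subScaled : List ℤ → ℤ → List ℤ → List ℤ
subScaled [] c t = []
subScaled r c [] = r
subScaled (x ∷ r) c (y ∷ t) = (x ℤ.- c ℤ.* y) ∷ subScaled r c t

-- k quotient coefficients (highest first) of r ÷ g, g monic (head g = 1)
divH : ℕ → List ℤ → List ℤ → List ℤ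
divH zero r g = []
divH (suc k) [] g = []
divH (suc k) (c ∷ r) [] = []
divH (suc k) (c ∷ r) (l ∷ t) = c ∷ divH k (subScaled r c t) (l ∷ t)

pdiv : List ℤ → List ℤ → List ℤ
pdiv f g = reverse (divH (suc (length f ∸ length g)) (reverse f) (reverse g))

-- Cyclotomic polynomials, by the standard recursive definition
--   Φ_n = (x^n - 1) / ∏_{d ∣ n, d < n} Φ_d   (exact division by a monic polynomial).
-- The first argument is fuel (recursion on d < n).

properDivisors : ℕ → List ℕ
properDivisors n = filter (λ d → d ∣? n) (drop 1 (upTo n))

cycloF : ℕ → ℕ → List ℤ
cycloF zero n = + 1 ∷ []
cycloF (suc f) n = pdiv (xn-1 n) (pprod (map (cycloF f) (properDivisors n)))

Φ : ℕ → List ℤ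
Φ n = cycloF n n

Word : Set
Word = List ℤ

In𝒜 : ℤ → Set
In𝒜 x = (x ≡ -[1+ 0 ]) ⊎ ((x ≡ + 0) ⊎ (x ≡ + 1))

In𝒜^ : ℕ → Word → Set
In𝒜^ p w = (length w ≡ p) × All In𝒜 w

cycloWord : ℕ → ℕ → Word
cycloWord p q = Φ (p ℕ.* q)

σ : Word → Word
σ [] = []
σ (x ∷ xs) = xs ++ (x ∷ [])

σ^ : ℕ → Word → Word
σ^ zero w = w
σ^ (suc k) w = σ (σ^ k w)

_⊕_ : Word → Word → Word
_⊕_ = zipWith ℤ._+_

_^ʷ_ : Word → ℕ → Word
v ^ʷ s = concat (replicate s v)

fpow : (p : ℕ) .{{_ : NonZero p}} → Word → ℕ → Word
fpow p v k = (v ^ʷ (k / p)) ++ take (k % p) v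

d₀ : ℕ → Word
d₀ p = + 1 ∷ -[1+ 0 ] ∷ replicate (p ∸ 2) (+ 0)

dw : ℕ → ℕ → ℕ → Word
dw p q i = σ^ (i ℕ.* q) (d₀ p)

ω : ℕ → ℕ → ℕ → Word
ω p q zero = d₀ p
ω p q (suc i) = ω p q i ⊕ dw p q (suc i)

bWord : (p : ℕ) .{{_ : NonZero p}} → ℕ → Word
bWord p q = concatMap (λ i → (ω p q i ^ʷ (q / p)) ++ fpow p (ω p q i) (q % p)) (upTo (p ∸ 1))

fracWord : (p : ℕ) .{{_ : NonZero p}} → ℕ → Word
fracWord p q = concatMap (λ i → fpow p (ω p q i) q) (upTo (p ∸ 2))
               ++ fpow p (ω p q (p ∸ 2)) (q ∸ p ℕ.+ 2)

-- Φ_pq = (x^{pq} - 1)(x - 1) / ((x^p - 1)(x^q - 1)), and Φ_p = 1 + x + ⋯ + x^{p-1}, so it suffices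
-- to show that the fractional-power word times Φ₁ Φ_p Φ_q is x^{pq} - 1 (exact division then
-- recovers it). Let W = ω₀^{q/p} ω₁^{q/p} ⋯ ω_{p-2}^{q/p}, of length (p - 1) q. The recursion
-- ω_i = ω_{i-1} + σ^{iq}(d₀) says that (x^q - 1) W = -(d₀ repeated q times), the top block
-- cancelling because ω_{p-1} = 0: as l runs over 0, …, p - 1, the shifts l q run over all residues
-- mod p, so the σ^{lq}(d₀) sum to zero. Multiplying by Φ_p then telescopes to x^{pq} - 1.
-- The same count of residues shows that each coordinate of ω_i, i ≤ p - 2, is [0 ∈ R] - [1 ∈ R]
-- for a set R of residues, hence lies in {-1, 0, 1}, and that W vanishes beyond degree
-- (p - 1)(q - 1), where it is cut off by both the fractional powers and the truncation of b_pq.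

module Submission where

open import Defs
open import Data.Nat using (ℕ; zero; suc; _∸_; _+_; _*_; _<_; _≤_; _≟_; _⊔_; z≤n; s≤s; NonZero)
import Data.Nat.Properties as ℕP
open import Data.Nat.DivMod
open import Data.Nat.Divisibility using (_∣_; divides; _∣?_; ∣⇒≤; ∣m+n∣m⇒∣n; m∣m*n; n∣m*n; 1∣_)
open import Data.Nat.Primality using (Prime; prime⇒irreducible; euclidsLemma; ¬prime[0]; ¬prime[1])
open import Data.Nat.Tactic.RingSolver as ℕ-Solver using ()
open import Data.Integer as ℤ using (ℤ; +_; -[1+_])
import Data.Integer.Properties as ℤP
open import Data.Integer.Tactic.RingSolver using (solve-∀)
open import Data.List using (List; []; _∷_; _++_; _∷ʳ_; map; concat; concatMap; replicate; length; reverse; applyUpTo; upTo; take; filter)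
import Data.List.Properties as LP
open import Data.List.Relation.Unary.All using (All; []; _∷_)
open import Data.Product using (_×_; ∃; _,_)
open import Data.Sum using (_⊎_; inj₁; inj₂)
open import Data.Empty using (⊥-elim)
open import Relation.Nullary using (¬_; Dec; yes; no)
open import Relation.Binary.Bundles using (Setoid)
open import Relation.Binary.PropositionalEquality

-- Polynomials as integer coefficient lists

coeff : List ℤ → ℕ → ℤ
coeff []       k       = + 0
coeff (x ∷ xs) zero    = x
coeff (x ∷ xs) (suc k) = coeff xs k

-- equality of polynomials: the coefficient lists agree up to trailing zeros
infix 4 _≈_
record _≈_ (f g : List ℤ) : Set where
  constructor mk≈
  field coeff-≡ : ∀ k → coeff f k ≡ coeff g k
open _≈_ public

≈-refl : ∀ {f} → f ≈ f
≈-refl = mk≈ λ _ → refl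

≈-sym : ∀ {f g} → f ≈ g → g ≈ f
≈-sym e = mk≈ λ k → sym (coeff-≡ e k)

≈-trans : ∀ {f g h} → f ≈ g → g ≈ h → f ≈ h
≈-trans e e′ = mk≈ λ k → trans (coeff-≡ e k) (coeff-≡ e′ k)

≈-setoid : Setoid _ _
≈-setoid = record
  { Carrier = List ℤ ; _≈_ = _≈_
  ; isEquivalence = record { refl = ≈-refl ; sym = ≈-sym ; trans = ≈-trans } }

≡⇒≈ : ∀ {f g} → f ≡ g → f ≈ g
≡⇒≈ refl = ≈-refl

≈∧length⇒≡ : ∀ {f g} → length f ≡ length g → f ≈ g → f ≡ g
≈∧length⇒≡ {[]}    {[]}    _ _ = refl
≈∧length⇒≡ {x ∷ f} {y ∷ g} l e =
  cong₂ _∷_ (coeff-≡ e 0) (≈∧length⇒≡ (ℕP.suc-injective l) (mk≈ λ k → coeff-≡ e (suc k)))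

coeff-≥length : ∀ u {k} → length u ≤ k → coeff u k ≡ + 0
coeff-≥length []      _         = refl
coeff-≥length (x ∷ u) (s≤s le) = coeff-≥length u le

coeff-++ˡ : ∀ xs ys {k} → k < length xs → coeff (xs ++ ys) k ≡ coeff xs k
coeff-++ˡ (x ∷ xs) ys {zero}  _        = refl
coeff-++ˡ (x ∷ xs) ys {suc k} (s≤s lt) = coeff-++ˡ xs ys lt

coeff-++ʳ : ∀ xs ys k → coeff (xs ++ ys) (length xs + k) ≡ coeff ys k
coeff-++ʳ []       ys k = refl
coeff-++ʳ (x ∷ xs) ys k = coeff-++ʳ xs ys k

coeff-applyUpTo : ∀ (f : ℕ → ℤ) {n k} → k < n → coeff (applyUpTo f n) k ≡ f k
coeff-applyUpTo f {suc n} {zero}  _        = refl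
coeff-applyUpTo f {suc n} {suc k} (s≤s lt) = coeff-applyUpTo (λ i → f (suc i)) lt

coeff-applyUpTo-≥ : ∀ (f : ℕ → ℤ) {n k} → n ≤ k → coeff (applyUpTo f n) k ≡ + 0
coeff-applyUpTo-≥ f {n} le = coeff-≥length (applyUpTo f n) (subst (_≤ _) (sym (LP.length-applyUpTo f n)) le)

coeff-zeros : ∀ n k → coeff (replicate n (+ 0)) k ≡ + 0
coeff-zeros zero    k       = refl
coeff-zeros (suc n) zero    = refl
coeff-zeros (suc n) (suc k) = coeff-zeros n k

coeff-take : ∀ n xs {k} → k < n → coeff (take n xs) k ≡ coeff xs k
coeff-take (suc n) []       _        = refl
coeff-take (suc n) (x ∷ xs) {zero}  _        = refl
coeff-take (suc n) (x ∷ xs) {suc k} (s≤s lt) = coeff-take n xs lt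

shift : ℕ → List ℤ → List ℤ
shift n u = replicate n (+ 0) ++ u

coeff-shift-< : ∀ n u {k} → k < n → coeff (shift n u) k ≡ + 0
coeff-shift-< (suc n) u {zero}  _        = refl
coeff-shift-< (suc n) u {suc k} (s≤s lt) = coeff-shift-< n u lt

coeff-shift-+ : ∀ n u k → coeff (shift n u) (n + k) ≡ coeff u k
coeff-shift-+ zero    u k = refl
coeff-shift-+ (suc n) u k = coeff-shift-+ n u k

shift-cong : ∀ n {u v} → u ≈ v → shift n u ≈ shift n v
shift-cong zero    e = e
shift-cong (suc n) e = mk≈ λ { zero → refl ; (suc k) → coeff-≡ (shift-cong n e) k }

coeff-padd : ∀ f g k → coeff (padd f g) k ≡ coeff f k ℤ.+ coeff g k
coeff-padd []      g       k       = sym (ℤP.+-identityˡ _)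
coeff-padd (a ∷ f) []      k       = sym (ℤP.+-identityʳ _)
coeff-padd (a ∷ f) (b ∷ g) zero    = refl
coeff-padd (a ∷ f) (b ∷ g) (suc k) = coeff-padd f g k

coeff-scale : ∀ c f k → coeff (map (c ℤ.*_) f) k ≡ c ℤ.* coeff f k
coeff-scale c []      k       = sym (ℤP.*-zeroʳ c)
coeff-scale c (a ∷ f) zero    = refl
coeff-scale c (a ∷ f) (suc k) = coeff-scale c f k

coeff-pmul-∷ : ∀ a f g k → coeff (pmul (a ∷ f) g) k ≡ a ℤ.* coeff g k ℤ.+ coeff (shift 1 (pmul f g)) k
coeff-pmul-∷ a f g k =
  trans (coeff-padd (map (a ℤ.*_) g) (shift 1 (pmul f g)) k) (cong (ℤ._+ coeff (shift 1 (pmul f g)) k) (coeff-scale a g k))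

padd-cong : ∀ {f f′ g g′} → f ≈ f′ → g ≈ g′ → padd f g ≈ padd f′ g′
padd-cong {f} {f′} {g} {g′} e e′ = mk≈ λ k → begin
  coeff (padd f g) k              ≡⟨ coeff-padd f g k ⟩
  coeff f k ℤ.+ coeff g k         ≡⟨ cong₂ ℤ._+_ (coeff-≡ e k) (coeff-≡ e′ k) ⟩
  coeff f′ k ℤ.+ coeff g′ k       ≡⟨ coeff-padd f′ g′ k ⟨
  coeff (padd f′ g′) k            ∎
  where open ≡-Reasoning

padd-comm : ∀ f g → padd f g ≈ padd g f
padd-comm f g = mk≈ λ k →
  trans (coeff-padd f g k) (trans (ℤP.+-comm (coeff f k) _) (sym (coeff-padd g f k)))

padd-assoc : ∀ f g h → padd (padd f g) h ≈ padd f (padd g h)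
padd-assoc f g h = mk≈ λ k → begin
  coeff (padd (padd f g) h) k                    ≡⟨ coeff-padd (padd f g) h k ⟩
  coeff (padd f g) k ℤ.+ coeff h k               ≡⟨ cong (ℤ._+ coeff h k) (coeff-padd f g k) ⟩
  coeff f k ℤ.+ coeff g k ℤ.+ coeff h k          ≡⟨ ℤP.+-assoc (coeff f k) _ _ ⟩
  coeff f k ℤ.+ (coeff g k ℤ.+ coeff h k)        ≡⟨ cong (ℤ._+_ (coeff f k)) (coeff-padd g h k) ⟨
  coeff f k ℤ.+ coeff (padd g h) k               ≡⟨ coeff-padd f (padd g h) k ⟨
  coeff (padd f (padd g h)) k                    ∎
  where open ≡-Reasoning

shift-padd : ∀ n f g → shift n (padd f g) ≈ padd (shift n f) (shift n g)
shift-padd zero    f g = ≈-refl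
shift-padd (suc n) f g = mk≈ λ { zero → refl ; (suc k) → coeff-≡ (shift-padd n f g) k }

scale-cong : ∀ c {f f′} → f ≈ f′ → map (c ℤ.*_) f ≈ map (c ℤ.*_) f′
scale-cong c {f} {f′} e = mk≈ λ k →
  trans (coeff-scale c f k) (trans (cong (c ℤ.*_) (coeff-≡ e k)) (sym (coeff-scale c f′ k)))

pmul-congʳ : ∀ f {g g′} → g ≈ g′ → pmul f g ≈ pmul f g′
pmul-congʳ []      e = ≈-refl
pmul-congʳ (a ∷ f) e = padd-cong (scale-cong a e) (shift-cong 1 (pmul-congʳ f e))

pmul-identityˡ : ∀ g → pmul (+ 1 ∷ []) g ≈ g
pmul-identityˡ g = mk≈ λ k → begin
  coeff (pmul (+ 1 ∷ []) g) k                    ≡⟨ coeff-pmul-∷ (+ 1) [] g k ⟩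
  + 1 ℤ.* coeff g k ℤ.+ coeff (+ 0 ∷ []) k       ≡⟨ cong₂ ℤ._+_ (ℤP.*-identityˡ (coeff g k)) (coeff-zeros 1 k) ⟩
  coeff g k ℤ.+ + 0                              ≡⟨ ℤP.+-identityʳ _ ⟩
  coeff g k                                      ∎
  where open ≡-Reasoning

pmul-shiftˡ : ∀ n f g → pmul (shift n f) g ≈ shift n (pmul f g)
pmul-shiftˡ zero    f g = ≈-refl
pmul-shiftˡ (suc n) f g = mk≈ λ k → begin
  coeff (pmul (shift (suc n) f) g) k
    ≡⟨ coeff-pmul-∷ (+ 0) (shift n f) g k ⟩
  + 0 ℤ.* coeff g k ℤ.+ coeff (shift 1 (pmul (shift n f) g)) k
    ≡⟨ cong (ℤ._+ coeff (shift 1 (pmul (shift n f) g)) k) (ℤP.*-zeroˡ (coeff g k)) ⟩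
  + 0 ℤ.+ coeff (shift 1 (pmul (shift n f) g)) k
    ≡⟨ ℤP.+-identityˡ _ ⟩
  coeff (shift 1 (pmul (shift n f) g)) k
    ≡⟨ coeff-≡ (shift-cong 1 (pmul-shiftˡ n f g)) k ⟩
  coeff (shift (suc n) (pmul f g)) k                           ∎
  where open ≡-Reasoning

pmul-[]ʳ : ∀ f → pmul f [] ≈ []
pmul-[]ʳ []      = ≈-refl
pmul-[]ʳ (a ∷ f) = mk≈ λ { zero → refl ; (suc k) → coeff-≡ (pmul-[]ʳ f) k }

pmul-∷ʳ : ∀ f b g → pmul f (b ∷ g) ≈ padd (map (b ℤ.*_) f) (shift 1 (pmul f g))
pmul-∷ʳ []      b g = mk≈ λ { zero → refl ; (suc k) → refl }
pmul-∷ʳ (a ∷ f) b g = mk≈ λ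
  { zero → swap₀ a b
  ; (suc k) → begin
      coeff (pmul (a ∷ f) (b ∷ g)) (suc k)
        ≡⟨ coeff-pmul-∷ a f (b ∷ g) (suc k) ⟩
      a ℤ.* coeff g k ℤ.+ coeff (pmul f (b ∷ g)) k
        ≡⟨ cong (ℤ._+_ (a ℤ.* coeff g k)) (coeff-≡ (pmul-∷ʳ f b g) k) ⟩
      a ℤ.* coeff g k ℤ.+ coeff (padd (map (b ℤ.*_) f) (shift 1 (pmul f g))) k
        ≡⟨ cong (ℤ._+_ (a ℤ.* coeff g k)) (trans (coeff-padd (map (b ℤ.*_) f) (shift 1 (pmul f g)) k) (cong (ℤ._+ coeff (shift 1 (pmul f g)) k) (coeff-scale b f k))) ⟩
      a ℤ.* coeff g k ℤ.+ (b ℤ.* coeff f k ℤ.+ coeff (shift 1 (pmul f g)) k)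
        ≡⟨ swap₁ (a ℤ.* coeff g k) (b ℤ.* coeff f k) (coeff (shift 1 (pmul f g)) k) ⟩
      b ℤ.* coeff f k ℤ.+ (a ℤ.* coeff g k ℤ.+ coeff (shift 1 (pmul f g)) k)
        ≡⟨ cong₂ ℤ._+_ (coeff-scale b f k) (coeff-pmul-∷ a f g k) ⟨
      coeff (map (b ℤ.*_) f) k ℤ.+ coeff (pmul (a ∷ f) g) k
        ≡⟨ coeff-padd (map (b ℤ.*_) f) (pmul (a ∷ f) g) k ⟨
      coeff (padd (map (b ℤ.*_) (a ∷ f)) (shift 1 (pmul (a ∷ f) g))) (suc k) ∎ }
  where
  open ≡-Reasoning
  swap₀ : ∀ a b → a ℤ.* b ℤ.+ + 0 ≡ b ℤ.* a ℤ.+ + 0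
  swap₀ = solve-∀
  swap₁ : ∀ x y z → x ℤ.+ (y ℤ.+ z) ≡ y ℤ.+ (x ℤ.+ z)
  swap₁ = solve-∀

pmul-comm : ∀ f g → pmul f g ≈ pmul g f
pmul-comm []      g = ≈-sym (pmul-[]ʳ g)
pmul-comm (a ∷ f) g =
  ≈-trans (padd-cong (≈-refl {map (a ℤ.*_) g}) (shift-cong 1 (pmul-comm f g))) (≈-sym (pmul-∷ʳ g a f))

pmul-congˡ : ∀ {f f′} g → f ≈ f′ → pmul f g ≈ pmul f′ g
pmul-congˡ {f} {f′} g e = ≈-trans (pmul-comm f g) (≈-trans (pmul-congʳ g e) (pmul-comm g f′))

pmul-distribʳ : ∀ f f′ g → pmul (padd f f′) g ≈ padd (pmul f g) (pmul f′ g)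
pmul-distribʳ []      f′       g = ≈-refl
pmul-distribʳ (a ∷ f) []       g = mk≈ λ k → sym (trans (coeff-padd (pmul (a ∷ f) g) [] k) (ℤP.+-identityʳ _))
pmul-distribʳ (a ∷ f) (b ∷ f′) g = mk≈ λ k → begin
  coeff (pmul (a ℤ.+ b ∷ padd f f′) g) k
    ≡⟨ coeff-pmul-∷ (a ℤ.+ b) (padd f f′) g k ⟩
  (a ℤ.+ b) ℤ.* coeff g k ℤ.+ coeff (shift 1 (pmul (padd f f′) g)) k
    ≡⟨ cong (ℤ._+_ ((a ℤ.+ b) ℤ.* coeff g k)) (trans (coeff-≡ shifted k) (coeff-padd (shift 1 (pmul f g)) (shift 1 (pmul f′ g)) k)) ⟩
  (a ℤ.+ b) ℤ.* coeff g k ℤ.+ (coeff (shift 1 (pmul f g)) k ℤ.+ coeff (shift 1 (pmul f′ g)) k)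
    ≡⟨ distrib a b (coeff g k) _ _ ⟩
  (a ℤ.* coeff g k ℤ.+ coeff (shift 1 (pmul f g)) k) ℤ.+ (b ℤ.* coeff g k ℤ.+ coeff (shift 1 (pmul f′ g)) k)
    ≡⟨ cong₂ ℤ._+_ (coeff-pmul-∷ a f g k) (coeff-pmul-∷ b f′ g k) ⟨
  coeff (pmul (a ∷ f) g) k ℤ.+ coeff (pmul (b ∷ f′) g) k
    ≡⟨ coeff-padd (pmul (a ∷ f) g) (pmul (b ∷ f′) g) k ⟨
  coeff (padd (pmul (a ∷ f) g) (pmul (b ∷ f′) g)) k ∎
  where
  open ≡-Reasoning
  shifted : shift 1 (pmul (padd f f′) g) ≈ padd (shift 1 (pmul f g)) (shift 1 (pmul f′ g))
  shifted = ≈-trans (shift-cong 1 (pmul-distribʳ f f′ g)) (shift-padd 1 (pmul f g) _)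
  distrib : ∀ a b x y z → (a ℤ.+ b) ℤ.* x ℤ.+ (y ℤ.+ z) ≡ (a ℤ.* x ℤ.+ y) ℤ.+ (b ℤ.* x ℤ.+ z)
  distrib = solve-∀

pmul-scaleˡ : ∀ c f g → pmul (map (c ℤ.*_) f) g ≈ map (c ℤ.*_) (pmul f g)
pmul-scaleˡ c []      g = ≈-refl
pmul-scaleˡ c (a ∷ f) g = mk≈ λ k → begin
  coeff (pmul (c ℤ.* a ∷ map (c ℤ.*_) f) g) k
    ≡⟨ coeff-pmul-∷ (c ℤ.* a) (map (c ℤ.*_) f) g k ⟩
  c ℤ.* a ℤ.* coeff g k ℤ.+ coeff (shift 1 (pmul (map (c ℤ.*_) f) g)) k
    ≡⟨ cong (ℤ._+_ (c ℤ.* a ℤ.* coeff g k)) (shifted k) ⟩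
  c ℤ.* a ℤ.* coeff g k ℤ.+ c ℤ.* coeff (shift 1 (pmul f g)) k
    ≡⟨ factor c a (coeff g k) _ ⟩
  c ℤ.* (a ℤ.* coeff g k ℤ.+ coeff (shift 1 (pmul f g)) k)
    ≡⟨ cong (c ℤ.*_) (coeff-pmul-∷ a f g k) ⟨
  c ℤ.* coeff (pmul (a ∷ f) g) k
    ≡⟨ coeff-scale c (pmul (a ∷ f) g) k ⟨
  coeff (map (c ℤ.*_) (pmul (a ∷ f) g)) k ∎
  where
  open ≡-Reasoning
  shifted : ∀ k → coeff (shift 1 (pmul (map (c ℤ.*_) f) g)) k ≡ c ℤ.* coeff (shift 1 (pmul f g)) k
  shifted zero    = sym (ℤP.*-zeroʳ c)
  shifted (suc k) = trans (coeff-≡ (pmul-scaleˡ c f g) k) (coeff-scale c (pmul f g) k)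
  factor : ∀ c a x z → c ℤ.* a ℤ.* x ℤ.+ c ℤ.* z ≡ c ℤ.* (a ℤ.* x ℤ.+ z)
  factor = solve-∀

pmul-assoc : ∀ f g h → pmul (pmul f g) h ≈ pmul f (pmul g h)
pmul-assoc []      g h = ≈-refl
pmul-assoc (a ∷ f) g h =
  ≈-trans (pmul-distribʳ (map (a ℤ.*_) g) (shift 1 (pmul f g)) h)
    (padd-cong (pmul-scaleˡ a g h) (≈-trans (pmul-shiftˡ 1 (pmul f g) h) (shift-cong 1 (pmul-assoc f g h))))

pmul-++ˡ : ∀ u v g → pmul (u ++ v) g ≈ padd (pmul u g) (shift (length u) (pmul v g))
pmul-++ˡ []      v g = ≈-refl
pmul-++ˡ (a ∷ u) v g =
  ≈-trans (padd-cong (≈-refl {map (a ℤ.*_) g})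
                     (≈-trans (shift-cong 1 (pmul-++ˡ u v g)) (shift-padd 1 (pmul u g) _)))
          (≈-sym (padd-assoc (map (a ℤ.*_) g) (shift 1 (pmul u g)) _))

length-padd : ∀ f g → length (padd f g) ≡ length f ⊔ length g
length-padd []      g       = refl
length-padd (a ∷ f) []      = refl
length-padd (a ∷ f) (b ∷ g) = cong suc (length-padd f g)

length-pmul : ∀ f g {m n} → length f ≡ suc m → length g ≡ suc n → length (pmul f g) ≡ suc (m + n)
length-pmul (a ∷ [])     (b ∷ g) refl refl = begin
  length (padd (map (a ℤ.*_) (b ∷ g)) (+ 0 ∷ [])) ≡⟨ length-padd (map (a ℤ.*_) (b ∷ g)) (+ 0 ∷ []) ⟩
  suc (length (map (a ℤ.*_) g) ⊔ 0)              ≡⟨ cong suc (ℕP.⊔-identityʳ _) ⟩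
  suc (length (map (a ℤ.*_) g))                  ≡⟨ cong suc (LP.length-map (a ℤ.*_) g) ⟩
  suc (length g)                                 ∎
  where open ≡-Reasoning
length-pmul (a ∷ a′ ∷ f) (b ∷ g) refl refl = begin
  length (padd (map (a ℤ.*_) (b ∷ g)) (+ 0 ∷ pmul (a′ ∷ f) (b ∷ g)))
    ≡⟨ length-padd (map (a ℤ.*_) (b ∷ g)) (+ 0 ∷ pmul (a′ ∷ f) (b ∷ g)) ⟩
  suc (length (map (a ℤ.*_) g) ⊔ length (pmul (a′ ∷ f) (b ∷ g)))
    ≡⟨ cong₂ (λ x y → suc (x ⊔ y)) (LP.length-map (a ℤ.*_) g) (length-pmul (a′ ∷ f) (b ∷ g) refl refl) ⟩
  suc (length g ⊔ suc (length f + length g))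
    ≡⟨ cong suc (ℕP.m≤n⇒m⊔n≡n (ℕP.m≤n⇒m≤1+n (ℕP.m≤n+m (length g) (length f)))) ⟩
  suc (suc (length f + length g)) ∎
  where open ≡-Reasoning

length-xn-1 : ∀ n → length (xn-1 (suc n)) ≡ suc (suc n)
length-xn-1 n = cong suc (trans (LP.length-++ (replicate n (+ 0))) (trans (cong (_+ 1) (LP.length-replicate n)) (ℕP.+-comm n 1)))

neg : List ℤ → List ℤ
neg = map (-[1+ 0 ] ℤ.*_)

-- xⁿ - 1 for every n; Defs' xn-1 n is this only for n ≥ 1 (definitionally), xn-1 0 is junk
x^[_]-1 : ℕ → List ℤ
x^[ n ]-1 = padd (-[1+ 0 ] ∷ []) (shift n (+ 1 ∷ []))

shift-+ : ∀ m n u → shift (m + n) u ≡ shift m (shift n u)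
shift-+ zero    n u = refl
shift-+ (suc m) n u = cong (+ 0 ∷_) (shift-+ m n u)

shift-[0] : ∀ m → shift m (+ 0 ∷ []) ≈ []
shift-[0] m = mk≈ λ k → trans (coeff-≡ (shift-cong m (mk≈ λ { zero → refl ; (suc _) → refl })) k)
                              (trans (cong (λ u → coeff u k) (LP.++-identityʳ (replicate m (+ 0)))) (coeff-zeros m k))

x^[+]-1 : ∀ m n → padd x^[ m ]-1 (shift m x^[ n ]-1) ≈ x^[ m + n ]-1
x^[+]-1 m n = begin
  padd (padd a (shift m b)) (shift m (padd a (shift n b)))
    ≈⟨ padd-cong (≈-refl {padd a (shift m b)}) (≈-trans (shift-padd m a (shift n b)) (≡⇒≈ (cong (padd (shift m a)) (sym (shift-+ m n b))))) ⟩
  padd (padd a (shift m b)) (padd (shift m a) (shift (m + n) b))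
    ≈⟨ padd-assoc a (shift m b) _ ⟩
  padd a (padd (shift m b) (padd (shift m a) (shift (m + n) b)))
    ≈⟨ padd-cong (≈-refl {a}) (padd-assoc (shift m b) (shift m a) (shift (m + n) b)) ⟨
  padd a (padd (padd (shift m b) (shift m a)) (shift (m + n) b))
    ≈⟨ padd-cong (≈-refl {a}) (padd-cong (≈-trans (≈-sym (shift-padd m b a)) (shift-[0] m)) (≈-refl {shift (m + n) b})) ⟩
  padd a (shift (m + n) b) ∎
  where
  open import Relation.Binary.Reasoning.Setoid ≈-setoid
  a b : List ℤ
  a = -[1+ 0 ] ∷ []
  b = + 1 ∷ []

coeff-pmul-xn-1 : ∀ n g k → coeff (pmul (xn-1 (suc n)) g) k ≡ coeff (shift (suc n) g) k ℤ.- coeff g k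
coeff-pmul-xn-1 n g k = begin
  coeff (pmul (-[1+ 0 ] ∷ shift n (+ 1 ∷ [])) g) k
    ≡⟨ coeff-pmul-∷ -[1+ 0 ] (shift n (+ 1 ∷ [])) g k ⟩
  -[1+ 0 ] ℤ.* coeff g k ℤ.+ coeff (shift 1 (pmul (shift n (+ 1 ∷ [])) g)) k
    ≡⟨ cong (ℤ._+_ (-[1+ 0 ] ℤ.* coeff g k)) (coeff-≡ (shift-cong 1 (≈-trans (pmul-shiftˡ n (+ 1 ∷ []) g) (shift-cong n (pmul-identityˡ g)))) k) ⟩
  -[1+ 0 ] ℤ.* coeff g k ℤ.+ coeff (shift (suc n) g) k
    ≡⟨ swap (coeff g k) (coeff (shift (suc n) g) k) ⟩
  coeff (shift (suc n) g) k ℤ.- coeff g k ∎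
  where
  open ≡-Reasoning
  swap : ∀ x y → -[1+ 0 ] ℤ.* x ℤ.+ y ≡ y ℤ.- x
  swap = solve-∀

-- Reversal and exact division

coeff-reverse : ∀ u {k} → k < length u → coeff (reverse u) k ≡ coeff u (length u ∸ suc k)
coeff-reverse (x ∷ u) {k} lt rewrite LP.unfold-reverse x u with ℕP.<-≤-connex k (length u)
... | inj₁ k<u = begin
  coeff (reverse u ++ x ∷ []) k       ≡⟨ coeff-++ˡ (reverse u) (x ∷ []) (subst (k <_) (sym (LP.length-reverse u)) k<u) ⟩
  coeff (reverse u) k                 ≡⟨ coeff-reverse u k<u ⟩
  coeff u (length u ∸ suc k)          ≡⟨ cong (coeff (x ∷ u)) (ℕP.+-∸-assoc 1 k<u) ⟨
  coeff (x ∷ u) (length u ∸ k)        ∎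
  where open ≡-Reasoning
... | inj₂ u≤k with ℕP.≤-antisym u≤k (ℕP.≤-pred lt)
... | refl = begin
  coeff (reverse u ++ x ∷ []) (length u)
    ≡⟨ cong (coeff (reverse u ++ x ∷ [])) (trans (sym (LP.length-reverse u)) (sym (ℕP.+-identityʳ _))) ⟩
  coeff (reverse u ++ x ∷ []) (length (reverse u) + 0)
    ≡⟨ coeff-++ʳ (reverse u) (x ∷ []) 0 ⟩
  x
    ≡⟨ cong (coeff (x ∷ u)) (ℕP.n∸n≡0 (length u)) ⟨
  coeff (x ∷ u) (length u ∸ length u)                    ∎
  where open ≡-Reasoning

-- reversal relative to degree n; unlike reverse, it commutes with padd
revUpTo : ℕ → List ℤ → List ℤ
revUpTo n u = applyUpTo (λ k → coeff u (n ∸ suc k)) n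

coeff-revUpTo-< : ∀ n u {k} → k < n → coeff (revUpTo n u) k ≡ coeff u (n ∸ suc k)
coeff-revUpTo-< n u = coeff-applyUpTo (λ k → coeff u (n ∸ suc k))

coeff-revUpTo-≥ : ∀ n u {k} → n ≤ k → coeff (revUpTo n u) k ≡ + 0
coeff-revUpTo-≥ n u = coeff-applyUpTo-≥ (λ k → coeff u (n ∸ suc k))

reverse≈revUpTo : ∀ u → reverse u ≈ revUpTo (length u) u
reverse≈revUpTo u = mk≈ λ k → case k
  where
  case : ∀ k → coeff (reverse u) k ≡ coeff (revUpTo (length u) u) k
  case k with ℕP.<-≤-connex k (length u)
  ... | inj₁ lt = trans (coeff-reverse u lt) (sym (coeff-revUpTo-< (length u) u lt))
  ... | inj₂ ge = trans (coeff-≥length (reverse u) (subst (_≤ k) (sym (LP.length-reverse u)) ge))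
                        (sym (coeff-revUpTo-≥ (length u) u ge))

revUpTo-padd : ∀ n u v → revUpTo n (padd u v) ≈ padd (revUpTo n u) (revUpTo n v)
revUpTo-padd n u v = mk≈ λ k → trans (case k) (sym (coeff-padd (revUpTo n u) (revUpTo n v) k))
  where
  case : ∀ k → coeff (revUpTo n (padd u v)) k ≡ coeff (revUpTo n u) k ℤ.+ coeff (revUpTo n v) k
  case k with ℕP.<-≤-connex k n
  ... | inj₁ lt = trans (coeff-revUpTo-< n (padd u v) lt)
                    (trans (coeff-padd u v _) (sym (cong₂ ℤ._+_ (coeff-revUpTo-< n u lt) (coeff-revUpTo-< n v lt))))
  ... | inj₂ ge = trans (coeff-revUpTo-≥ n (padd u v) ge)
                    (sym (cong₂ ℤ._+_ (coeff-revUpTo-≥ n u ge) (coeff-revUpTo-≥ n v ge)))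

revUpTo-shift1 : ∀ n u → revUpTo (suc n) (shift 1 u) ≈ revUpTo n u
revUpTo-shift1 n u = mk≈ λ k → case k
  where
  case : ∀ k → coeff (revUpTo (suc n) (shift 1 u)) k ≡ coeff (revUpTo n u) k
  case k with ℕP.<-≤-connex k n
  ... | inj₁ lt = trans (coeff-revUpTo-< (suc n) (shift 1 u) (ℕP.m<n⇒m<1+n lt))
                    (trans (cong (coeff (shift 1 u)) (ℕP.+-∸-assoc 1 lt)) (sym (coeff-revUpTo-< n u lt)))
  ... | inj₂ ge with ℕP.<-≤-connex k (suc n)
  ...   | inj₁ lt = trans (coeff-revUpTo-< (suc n) (shift 1 u) lt)
                      (trans (cong (coeff (shift 1 u)) (ℕP.m≤n⇒m∸n≡0 ge)) (sym (coeff-revUpTo-≥ n u ge)))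
  ...   | inj₂ ge′ = trans (coeff-revUpTo-≥ (suc n) (shift 1 u) ge′) (sym (coeff-revUpTo-≥ n u ge))

revUpTo-[] : ∀ n → revUpTo n [] ≈ []
revUpTo-[] n = mk≈ λ k → case k
  where
  case : ∀ k → coeff (revUpTo n []) k ≡ + 0
  case k with ℕP.<-≤-connex k n
  ... | inj₁ lt = coeff-revUpTo-< n [] lt
  ... | inj₂ ge = coeff-revUpTo-≥ n [] ge

revUpTo-+length : ∀ m u → revUpTo (m + length u) u ≈ shift m (reverse u)
revUpTo-+length m u = mk≈ λ k → case k
  where
  n : ℕ
  n = m + length u
  case : ∀ k → coeff (revUpTo n u) k ≡ coeff (shift m (reverse u)) k
  case k with ℕP.<-≤-connex k m
  ... | inj₁ k<m = begin
    coeff (revUpTo n u) k     ≡⟨ coeff-revUpTo-< n u (ℕP.<-≤-trans k<m (ℕP.m≤m+n m (length u))) ⟩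
    coeff u (n ∸ suc k)       ≡⟨ coeff-≥length u (ℕP.≤-trans (ℕP.≤-reflexive (sym (ℕP.m+n∸m≡n m (length u)))) (ℕP.∸-monoʳ-≤ n k<m)) ⟩
    + 0                       ≡⟨ coeff-shift-< m (reverse u) k<m ⟨
    coeff (shift m (reverse u)) k ∎
    where
    open ≡-Reasoning
  ... | inj₂ m≤k with ℕP.m≤n⇒∃[o]m+o≡n m≤k
  ...   | j , refl with ℕP.<-≤-connex j (length u)
  ...     | inj₁ j<u = begin
    coeff (revUpTo n u) (m + j)
      ≡⟨ coeff-revUpTo-< n u (ℕP.+-monoʳ-< m j<u) ⟩
    coeff u (n ∸ suc (m + j))
      ≡⟨ cong (coeff u) (trans (cong (n ∸_) (sym (ℕP.+-suc m j))) (ℕP.[m+n]∸[m+o]≡n∸o m (length u) (suc j))) ⟩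
    coeff u (length u ∸ suc j)
      ≡⟨ coeff-reverse u j<u ⟨
    coeff (reverse u) j
      ≡⟨ coeff-shift-+ m (reverse u) j ⟨
    coeff (shift m (reverse u)) (m + j) ∎
    where
    open ≡-Reasoning
  ...     | inj₂ u≤j = begin
    coeff (revUpTo n u) (m + j)      ≡⟨ coeff-revUpTo-≥ n u (ℕP.+-monoʳ-≤ m u≤j) ⟩
    + 0                              ≡⟨ coeff-≥length (reverse u) (subst (_≤ j) (sym (LP.length-reverse u)) u≤j) ⟨
    coeff (reverse u) j              ≡⟨ coeff-shift-+ m (reverse u) j ⟨
    coeff (shift m (reverse u)) (m + j) ∎
    where
    open ≡-Reasoning

pmul-constˡ : ∀ a g → pmul (a ∷ []) g ≈ map (a ℤ.*_) g
pmul-constˡ a g = mk≈ λ k →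
  trans (coeff-padd (map (a ℤ.*_) g) (+ 0 ∷ []) k)
        (trans (cong (ℤ._+_ (coeff (map (a ℤ.*_) g) k)) (coeff-zeros 1 k)) (ℤP.+-identityʳ _))

revUpTo-pmul : ∀ f b g → revUpTo (length f + length g) (pmul f (b ∷ g)) ≈ pmul (reverse f) (reverse (b ∷ g))
revUpTo-pmul []      b g = revUpTo-[] (length g)
revUpTo-pmul (a ∷ f) b g = begin
  revUpTo (suc (length f + length g)) (pmul (a ∷ f) (b ∷ g))
    ≈⟨ revUpTo-padd (suc (length f + length g)) (map (a ℤ.*_) (b ∷ g)) (shift 1 (pmul f (b ∷ g))) ⟩
  padd (revUpTo (suc (length f + length g)) (map (a ℤ.*_) (b ∷ g)))
       (revUpTo (suc (length f + length g)) (shift 1 (pmul f (b ∷ g))))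
    ≈⟨ padd-cong leading (≈-trans (revUpTo-shift1 _ (pmul f (b ∷ g))) (revUpTo-pmul f b g)) ⟩
  padd (shift (length f) (map (a ℤ.*_) (reverse (b ∷ g)))) (pmul (reverse f) (reverse (b ∷ g)))
    ≈⟨ padd-comm (shift (length f) (map (a ℤ.*_) (reverse (b ∷ g)))) (pmul (reverse f) (reverse (b ∷ g))) ⟩
  padd (pmul (reverse f) (reverse (b ∷ g))) (shift (length f) (map (a ℤ.*_) (reverse (b ∷ g))))
    ≈⟨ padd-cong (≈-refl {pmul (reverse f) (reverse (b ∷ g))}) shifted ⟨
  padd (pmul (reverse f) (reverse (b ∷ g))) (shift (length (reverse f)) (pmul (a ∷ []) (reverse (b ∷ g))))
    ≈⟨ pmul-++ˡ (reverse f) (a ∷ []) (reverse (b ∷ g)) ⟨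
  pmul (reverse f ++ a ∷ []) (reverse (b ∷ g))
    ≡⟨ cong (λ h → pmul h (reverse (b ∷ g))) (LP.unfold-reverse a f) ⟨
  pmul (reverse (a ∷ f)) (reverse (b ∷ g)) ∎
  where
  open import Relation.Binary.Reasoning.Setoid ≈-setoid
  leading : revUpTo (suc (length f + length g)) (map (a ℤ.*_) (b ∷ g))
          ≈ shift (length f) (map (a ℤ.*_) (reverse (b ∷ g)))
  leading = ≈-trans (≡⇒≈ (cong (λ n → revUpTo n (map (a ℤ.*_) (b ∷ g)))
                            (trans (sym (ℕP.+-suc (length f) (length g)))
                                   (cong (_+_ (length f)) (sym (LP.length-map (a ℤ.*_) (b ∷ g)))))))
            (≈-trans (revUpTo-+length (length f) (map (a ℤ.*_) (b ∷ g)))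
                     (≡⇒≈ (cong (shift (length f)) (sym (LP.reverse-map (a ℤ.*_) (b ∷ g))))))
  shifted : shift (length (reverse f)) (pmul (a ∷ []) (reverse (b ∷ g)))
          ≈ shift (length f) (map (a ℤ.*_) (reverse (b ∷ g)))
  shifted = ≈-trans (≡⇒≈ (cong (λ n → shift n (pmul (a ∷ []) (reverse (b ∷ g)))) (LP.length-reverse f)))
                    (shift-cong (length f) (pmul-constˡ a (reverse (b ∷ g))))

reverse-pmul : ∀ a f b g → reverse (pmul (a ∷ f) (b ∷ g)) ≡ pmul (reverse (a ∷ f)) (reverse (b ∷ g))
reverse-pmul a f b g = ≈∧length⇒≡ lengths
  (≈-trans (reverse≈revUpTo (pmul (a ∷ f) (b ∷ g)))
  (≈-trans (≡⇒≈ (cong (λ n → revUpTo n (pmul (a ∷ f) (b ∷ g))) (length-pmul (a ∷ f) (b ∷ g) refl refl)))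
           (revUpTo-pmul (a ∷ f) b g)))
  where
  lengths : length (reverse (pmul (a ∷ f) (b ∷ g))) ≡ length (pmul (reverse (a ∷ f)) (reverse (b ∷ g)))
  lengths = begin
    length (reverse (pmul (a ∷ f) (b ∷ g)))         ≡⟨ LP.length-reverse (pmul (a ∷ f) (b ∷ g)) ⟩
    length (pmul (a ∷ f) (b ∷ g))                   ≡⟨ length-pmul (a ∷ f) (b ∷ g) refl refl ⟩
    suc (length f + length g)                       ≡⟨ length-pmul (reverse (a ∷ f)) (reverse (b ∷ g))
                                                         (LP.length-reverse (a ∷ f)) (LP.length-reverse (b ∷ g)) ⟨
    length (pmul (reverse (a ∷ f)) (reverse (b ∷ g))) ∎
    where
    open ≡-Reasoning

Monic : List ℤ → Set
Monic g = ∃ λ t → reverse g ≡ + 1 ∷ t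

pmul-monic : ∀ f g → Monic f → Monic g → Monic (pmul f g)
pmul-monic []      g       (_ , ())
pmul-monic (a ∷ f) []      _ (_ , ())
pmul-monic (a ∷ f) (b ∷ g) (t , ef) (t′ , eg) = _ , trans (reverse-pmul a f b g) (cong₂ pmul ef eg)

subScaled-padd : ∀ c t u → length t ≤ length u → subScaled (padd (map (c ℤ.*_) t) u) c t ≡ u
subScaled-padd c []      []      _        = refl
subScaled-padd c []      (x ∷ u) _        = refl
subScaled-padd c (y ∷ t) (x ∷ u) (s≤s le) = cong₂ _∷_ (cancel c y x) (subScaled-padd c t u le)
  where
  cancel : ∀ c y x → (c ℤ.* y ℤ.+ x) ℤ.- c ℤ.* y ≡ x
  cancel = solve-∀

divH-pmul : ∀ Q t → divH (length Q) (pmul Q (+ 1 ∷ t)) (+ 1 ∷ t) ≡ Q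
divH-pmul []           t = refl
divH-pmul (c ∷ [])     t = cong (_∷ []) (unit c)
  where
  unit : ∀ c → c ℤ.* + 1 ℤ.+ + 0 ≡ c
  unit = solve-∀
divH-pmul (c ∷ c′ ∷ Q) t = cong₂ _∷_ (unit c) (begin
  divH (suc (length Q)) (subScaled (padd (map (c ℤ.*_) t) P) (c ℤ.* + 1 ℤ.+ + 0) t) (+ 1 ∷ t)
    ≡⟨ cong (λ h → divH (suc (length Q)) (subScaled (padd (map (c ℤ.*_) t) P) h t) (+ 1 ∷ t)) (unit c) ⟩
  divH (suc (length Q)) (subScaled (padd (map (c ℤ.*_) t) P) c t) (+ 1 ∷ t)
    ≡⟨ cong (λ r → divH (suc (length Q)) r (+ 1 ∷ t)) (subScaled-padd c t P t≤P) ⟩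
  divH (suc (length Q)) P (+ 1 ∷ t)
    ≡⟨ divH-pmul (c′ ∷ Q) t ⟩
  c′ ∷ Q ∎)
  where
  open ≡-Reasoning
  P : List ℤ
  P = pmul (c′ ∷ Q) (+ 1 ∷ t)
  unit : ∀ c → c ℤ.* + 1 ℤ.+ + 0 ≡ c
  unit = solve-∀
  t≤P : length t ≤ length P
  t≤P = subst (length t ≤_) (sym (length-pmul (c′ ∷ Q) (+ 1 ∷ t) refl refl))
              (ℕP.m≤n⇒m≤1+n (ℕP.m≤n+m (length t) (length Q)))

pdiv-pmul : ∀ Q G → 1 ≤ length Q → Monic G → pdiv (pmul Q G) G ≡ Q
pdiv-pmul (q ∷ Q) []      _ (_ , ())
pdiv-pmul (q ∷ Q) (b ∷ g) _ (t , monic) = begin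
  reverse (divH (suc (length (pmul (q ∷ Q) (b ∷ g)) ∸ length (b ∷ g))) (reverse (pmul (q ∷ Q) (b ∷ g))) (reverse (b ∷ g)))
    ≡⟨ cong₂ (λ n r → reverse (divH n r (reverse (b ∷ g)))) quotient-length (reverse-pmul q Q b g) ⟩
  reverse (divH (length (reverse (q ∷ Q))) (pmul (reverse (q ∷ Q)) (reverse (b ∷ g))) (reverse (b ∷ g)))
    ≡⟨ cong (λ h → reverse (divH (length (reverse (q ∷ Q))) (pmul (reverse (q ∷ Q)) h) h)) monic ⟩
  reverse (divH (length (reverse (q ∷ Q))) (pmul (reverse (q ∷ Q)) (+ 1 ∷ t)) (+ 1 ∷ t))
    ≡⟨ cong reverse (divH-pmul (reverse (q ∷ Q)) t) ⟩
  reverse (reverse (q ∷ Q))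
    ≡⟨ LP.reverse-involutive (q ∷ Q) ⟩
  q ∷ Q ∎
  where
  open ≡-Reasoning
  quotient-length : suc (length (pmul (q ∷ Q) (b ∷ g)) ∸ length (b ∷ g)) ≡ length (reverse (q ∷ Q))
  quotient-length = begin
    suc (length (pmul (q ∷ Q) (b ∷ g)) ∸ suc (length g)) ≡⟨ cong (λ n → suc (n ∸ suc (length g))) (length-pmul (q ∷ Q) (b ∷ g) refl refl) ⟩
    suc (length Q + length g ∸ length g)                  ≡⟨ cong suc (ℕP.m+n∸n≡m (length Q) (length g)) ⟩
    length (q ∷ Q)                                        ≡⟨ LP.length-reverse (q ∷ Q) ⟨
    length (reverse (q ∷ Q))                              ∎

-- The cyclotomic polynomials Φ_p and Φ_pq

prime⇒≡2+ : ∀ {p} → Prime p → ∃ λ a → p ≡ suc (suc a)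
prime⇒≡2+ {0}           pp = ⊥-elim (¬prime[0] pp)
prime⇒≡2+ {1}           pp = ⊥-elim (¬prime[1] pp)
prime⇒≡2+ {suc (suc a)} _  = a , refl

∤-prime : ∀ {p q} → Prime q → 1 < p → p < q → ¬ p ∣ q
∤-prime q-prime 1<p p<q p∣q with prime⇒irreducible q-prime p∣q
... | inj₁ p≡1 = ℕP.<-irrefl (sym p≡1) 1<p
... | inj₂ p≡q = ℕP.<-irrefl p≡q p<q

∣p*q⇒ : ∀ {p q d} → Prime p → Prime q → d ∣ p * q → d ≡ 1 ⊎ d ≡ p ⊎ d ≡ q ⊎ d ≡ p * q
∣p*q⇒ {p} {q} {d} pp pq (divides e pq≡ed) with prime⇒≡2+ pp
... | _ , refl with euclidsLemma e d pp (divides q (trans (sym pq≡ed) (ℕP.*-comm p q)))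
... | inj₁ (divides e′ refl) with prime⇒irreducible pq (divides e′ (ℕP.*-cancelˡ-≡ q (e′ * d) p (trans pq≡ed (rearrange e′ p d))))
  where
  rearrange : ∀ x y z → x * y * z ≡ y * (x * z)
  rearrange x y z = trans (cong (_* z) (ℕP.*-comm x y)) (ℕP.*-assoc y x z)
...   | inj₁ refl = inj₁ refl
...   | inj₂ refl = inj₂ (inj₂ (inj₁ refl))
∣p*q⇒ {p} {q} {d} pp pq (divides e pq≡ed) | _ , refl | inj₂ (divides d′ refl)
  with prime⇒irreducible pq (divides e (ℕP.*-cancelˡ-≡ q (e * d′) p (trans pq≡ed (rearrange e d′ p))))
  where
  rearrange : ∀ x y z → x * (y * z) ≡ z * (x * y)
  rearrange x y z = trans (sym (ℕP.*-assoc x y z)) (ℕP.*-comm (x * y) z)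
... | inj₁ refl = inj₂ (inj₁ (ℕP.*-identityˡ p))
... | inj₂ refl = inj₂ (inj₂ (inj₂ (ℕP.*-comm q p)))

range : ℕ → ℕ → List ℕ
range a zero    = []
range a (suc n) = a ∷ range (suc a) n

range-++ : ∀ a m n → range a (m + n) ≡ range a m ++ range (a + m) n
range-++ a zero    n = cong (λ b → range b n) (sym (ℕP.+-identityʳ a))
range-++ a (suc m) n = cong (a ∷_) (trans (range-++ (suc a) m n) (cong (λ b → range (suc a) m ++ range b n) (sym (ℕP.+-suc a m))))

applyUpTo≡range : ∀ (f : ℕ → ℕ) a n → (∀ i → f i ≡ a + i) → applyUpTo f n ≡ range a n
applyUpTo≡range f a zero    _ = refl
applyUpTo≡range f a (suc n) f≗ =
  cong₂ _∷_ (trans (f≗ 0) (ℕP.+-identityʳ a)) (applyUpTo≡range (λ i → f (suc i)) (suc a) n (λ i → trans (f≗ (suc i)) (ℕP.+-suc a i)))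

properDivisors≡ : ∀ n → properDivisors n ≡ filter (_∣? n) (range 1 (n ∸ 1))
properDivisors≡ zero    = refl
properDivisors≡ (suc n) = cong (filter (_∣? suc n)) (applyUpTo≡range suc 1 n (λ _ → refl))

module _ {N : ℕ} where

  filter-range-gap : ∀ a n → (∀ d → a ≤ d → d < a + n → ¬ d ∣ N) → filter (_∣? N) (range a n) ≡ []
  filter-range-gap a n gap = LP.filter-none (_∣? N) (all a n gap)
    where
    all : ∀ a n → (∀ d → a ≤ d → d < a + n → ¬ d ∣ N) → All (λ d → ¬ d ∣ N) (range a n)
    all a zero    _   = []
    all a (suc n) gap = gap a ℕP.≤-refl (ℕP.m<m+n a (s≤s z≤n))
                      ∷ all (suc a) n (λ d a<d d< → gap d (ℕP.<⇒≤ a<d) (subst (d <_) (sym (ℕP.+-suc a n)) d<))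

  filter-range-step : ∀ a g m → a ∣ N → (∀ d → a < d → d < suc a + g → ¬ d ∣ N) →
                      filter (_∣? N) (range a (suc g + m)) ≡ a ∷ filter (_∣? N) (range (suc a + g) m)
  filter-range-step a g m a∣N gap = begin
    filter (_∣? N) (a ∷ range (suc a) (g + m))
      ≡⟨ LP.filter-accept (_∣? N) a∣N ⟩
    a ∷ filter (_∣? N) (range (suc a) (g + m))
      ≡⟨ cong (λ ds → a ∷ filter (_∣? N) ds) (range-++ (suc a) g m) ⟩
    a ∷ filter (_∣? N) (range (suc a) g ++ range (suc a + g) m)
      ≡⟨ cong (a ∷_) (LP.filter-++ (_∣? N) (range (suc a) g) _) ⟩
    a ∷ filter (_∣? N) (range (suc a) g) ++ filter (_∣? N) (range (suc a + g) m)
      ≡⟨ cong (λ ds → a ∷ ds ++ filter (_∣? N) (range (suc a + g) m)) (filter-range-gap (suc a) g gap) ⟩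
    a ∷ filter (_∣? N) (range (suc a + g) m) ∎
    where
    open ≡-Reasoning

properDivisors-prime : ∀ {p} → Prime p → properDivisors p ≡ 1 ∷ []
properDivisors-prime {p} pp with prime⇒≡2+ pp
... | a , refl = begin
  properDivisors p                                ≡⟨ properDivisors≡ p ⟩
  filter (_∣? p) (range 1 (suc a))                ≡⟨ cong (λ n → filter (_∣? p) (range 1 n)) (sym (ℕP.+-identityʳ (suc a))) ⟩
  filter (_∣? p) (range 1 (suc a + 0))            ≡⟨ filter-range-step 1 a 0 (1∣ p) gap ⟩
  1 ∷ []                                          ∎
  where
  open ≡-Reasoning
  gap : ∀ d → 1 < d → d < p → ¬ d ∣ p
  gap d 1<d d<p d∣p with prime⇒irreducible pp d∣p
  ... | inj₁ refl = ℕP.<-irrefl refl 1<d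
  ... | inj₂ refl = ℕP.<-irrefl refl d<p

properDivisors-pq : ∀ {p q} → Prime p → Prime q → p < q → properDivisors (p * q) ≡ 1 ∷ p ∷ q ∷ []
properDivisors-pq {p} {q} pp pq p<q with prime⇒≡2+ pp | ℕP.m≤n⇒∃[o]m+o≡n p<q
... | a , refl | o , refl = begin
  properDivisors (p * q)
    ≡⟨ properDivisors≡ (p * q) ⟩
  filter (_∣? p * q) (range 1 (p * q ∸ 1))
    ≡⟨ cong (λ n → filter (_∣? p * q) (range 1 n)) gaps ⟩
  filter (_∣? p * q) (range 1 (suc a + (suc o + (suc c + 0))))
    ≡⟨ filter-range-step 1 a _ (1∣ (p * q)) gap-1-p ⟩
  1 ∷ filter (_∣? p * q) (range p (suc o + (suc c + 0)))
    ≡⟨ cong (1 ∷_) (filter-range-step p o _ (m∣m*n q) gap-p-q) ⟩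
  1 ∷ p ∷ filter (_∣? p * q) (range q (suc c + 0))
    ≡⟨ cong (λ ds → 1 ∷ p ∷ ds) (filter-range-step q c 0 (n∣m*n p) (λ d q<d d< → gap-q-pq d q<d (subst (d <_) q+c≡pq d<))) ⟩
  1 ∷ p ∷ q ∷ []                                                        ∎
  where
  open ≡-Reasoning
  c : ℕ
  c = p * q ∸ suc q
  q<pq : q < p * q
  q<pq = subst (_< p * q) (ℕP.*-identityˡ q) (ℕP.*-monoˡ-< q {1} {p} (s≤s (s≤s z≤n)))
  q+c≡pq : suc q + c ≡ p * q
  q+c≡pq = ℕP.m+[n∸m]≡n q<pq
  gaps : p * q ∸ 1 ≡ suc a + (suc o + (suc c + 0))
  gaps = trans (cong (_∸ 1) (sym q+c≡pq)) (arith a o c)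
    where
    arith : ∀ a o c → suc (suc (suc a) + o) + c ≡ suc a + (suc o + (suc c + 0))
    arith = ℕ-Solver.solve-∀
  p≤pq : p ≤ p * q
  p≤pq = ℕP.m≤m*n p q
  gap-1-p : ∀ d → 1 < d → d < p → ¬ d ∣ p * q
  gap-1-p d 1<d d<p d∣pq with ∣p*q⇒ pp pq d∣pq
  ... | inj₁ refl                = ℕP.<-irrefl refl 1<d
  ... | inj₂ (inj₁ refl)         = ℕP.<-irrefl refl d<p
  ... | inj₂ (inj₂ (inj₁ refl))  = ℕP.<-asym d<p p<q
  ... | inj₂ (inj₂ (inj₂ refl))  = ℕP.<-irrefl refl (ℕP.<-≤-trans d<p p≤pq)
  gap-p-q : ∀ d → p < d → d < q → ¬ d ∣ p * q
  gap-p-q d p<d d<q d∣pq with ∣p*q⇒ pp pq d∣pq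
  ... | inj₁ refl                = ℕP.<-asym p<d (s≤s (s≤s z≤n))
  ... | inj₂ (inj₁ refl)         = ℕP.<-irrefl refl p<d
  ... | inj₂ (inj₂ (inj₁ refl))  = ℕP.<-irrefl refl d<q
  ... | inj₂ (inj₂ (inj₂ refl))  = ℕP.<-asym d<q q<pq
  gap-q-pq : ∀ d → q < d → d < p * q → ¬ d ∣ p * q
  gap-q-pq d q<d d<pq d∣pq with ∣p*q⇒ pp pq d∣pq
  ... | inj₁ refl                = ℕP.<-asym q<d (s≤s (s≤s z≤n))
  ... | inj₂ (inj₁ refl)         = ℕP.<-asym q<d p<q
  ... | inj₂ (inj₂ (inj₁ refl))  = ℕP.<-irrefl refl q<d
  ... | inj₂ (inj₂ (inj₂ refl))  = ℕP.<-irrefl refl d<pq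

ones : ℕ → List ℤ
ones n = replicate n (+ 1)

pmul-ones-x-1 : ∀ n → pmul (ones (suc n)) (xn-1 1) ≡ xn-1 (suc n)
pmul-ones-x-1 zero    = refl
pmul-ones-x-1 (suc n) = cong (λ r → padd (-[1+ 0 ] ∷ + 1 ∷ []) (+ 0 ∷ r)) (pmul-ones-x-1 n)

reverse-replicate : ∀ n (c : ℤ) → reverse (replicate n c) ≡ replicate n c
reverse-replicate zero    c = refl
reverse-replicate (suc n) c = begin
  reverse (c ∷ replicate n c)   ≡⟨ LP.unfold-reverse c (replicate n c) ⟩
  reverse (replicate n c) ∷ʳ c  ≡⟨ cong (_∷ʳ c) (reverse-replicate n c) ⟩
  replicate n c ∷ʳ c            ≡⟨ snoc n ⟩
  c ∷ replicate n c             ∎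
  where
  open ≡-Reasoning
  snoc : ∀ n → replicate n c ∷ʳ c ≡ c ∷ replicate n c
  snoc zero    = refl
  snoc (suc n) = cong (c ∷_) (snoc n)

monic-ones : ∀ n → Monic (ones (suc n))
monic-ones n = ones n , reverse-replicate (suc n) (+ 1)

monic-x-1 : Monic (xn-1 1)
monic-x-1 = -[1+ 0 ] ∷ [] , refl

cycloF-prime : ∀ f {p} → Prime p → cycloF (suc (suc f)) p ≡ ones p
cycloF-prime f {p} pp with prime⇒≡2+ pp
... | a , refl = begin
  pdiv (xn-1 p) (pprod (map (cycloF (suc f)) (properDivisors p)))
    ≡⟨ cong (λ ds → pdiv (xn-1 p) (pprod (map (cycloF (suc f)) ds))) (properDivisors-prime pp) ⟩
  pdiv (xn-1 p) (xn-1 1)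
    ≡⟨ cong (λ r → pdiv r (xn-1 1)) (pmul-ones-x-1 (suc a)) ⟨
  pdiv (pmul (ones p) (xn-1 1)) (xn-1 1)
    ≡⟨ pdiv-pmul (ones p) (xn-1 1) (s≤s z≤n) monic-x-1 ⟩
  ones p ∎
  where open ≡-Reasoning

Φ₁ΦₚΦq : ℕ → ℕ → List ℤ
Φ₁ΦₚΦq p q = pprod (xn-1 1 ∷ ones p ∷ ones q ∷ [])

Φ₁ΦₚΦq-monic : ∀ m n → Monic (Φ₁ΦₚΦq (suc m) (suc n))
Φ₁ΦₚΦq-monic m n =
  pmul-monic (xn-1 1) (pmul (ones (suc m)) (pmul (ones (suc n)) (+ 1 ∷ []))) monic-x-1
    (pmul-monic (ones (suc m)) (pmul (ones (suc n)) (+ 1 ∷ [])) (monic-ones m)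
      (pmul-monic (ones (suc n)) (+ 1 ∷ []) (monic-ones n) ([] , refl)))

cycloF-pq : ∀ f {p q} → Prime p → Prime q → p < q →
            cycloF (suc (suc (suc f))) (p * q) ≡ pdiv (xn-1 (p * q)) (Φ₁ΦₚΦq p q)
cycloF-pq f {p} {q} pp pq p<q = begin
  pdiv (xn-1 (p * q)) (pprod (map (cycloF (suc (suc f))) (properDivisors (p * q))))
    ≡⟨ cong (λ ds → pdiv (xn-1 (p * q)) (pprod (map (cycloF (suc (suc f))) ds))) (properDivisors-pq pp pq p<q) ⟩
  pdiv (xn-1 (p * q)) (pprod (xn-1 1 ∷ cycloF (suc (suc f)) p ∷ cycloF (suc (suc f)) q ∷ []))
    ≡⟨ cong₂ (λ Φp Φq → pdiv (xn-1 (p * q)) (pprod (xn-1 1 ∷ Φp ∷ Φq ∷ []))) (cycloF-prime f pp) (cycloF-prime f pq) ⟩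
  pdiv (xn-1 (p * q)) (Φ₁ΦₚΦq p q) ∎
  where open ≡-Reasoning

-- the fuel of cycloWord p q is p q itself, at least 3
cycloWord-pq : ∀ {p q} → Prime p → Prime q → p < q →
               cycloWord p q ≡ pdiv (xn-1 (p * q)) (Φ₁ΦₚΦq p q)
cycloWord-pq {p} {q} pp pq p<q with prime⇒≡2+ pp | ℕP.m≤n⇒∃[o]m+o≡n p<q
... | a , refl | o , refl = cycloF-pq (a + o + suc a * q) pp pq p<q

-- Residues and the words d_i, ω_i

module _ (n : ℕ) .{{_ : NonZero n}} where

  [r+in]%n≡r : ∀ {r} i → r < n → (r + i * n) % n ≡ r
  [r+in]%n≡r {r} i r<n = trans ([m+kn]%n≡m%n r i n) (m<n⇒m%n≡m r<n)

  [r+in]/n≡i : ∀ {r} i → r < n → (r + i * n) / n ≡ i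
  [r+in]/n≡i {r} i r<n = trans (+-distrib-/-∣ʳ r (n∣m*n i)) (cong₂ _+_ (m<n⇒m/n≡0 r<n) (m*n/n≡m i n))

  [m%n+k]%n≡[m+k]%n : ∀ m k → (m % n + k) % n ≡ (m + k) % n
  [m%n+k]%n≡[m+k]%n m k = begin
    (m % n + k) % n              ≡⟨ %-distribˡ-+ (m % n) k n ⟩
    (m % n % n + k % n) % n      ≡⟨ cong (λ r → (r + k % n) % n) (m%n%n≡m%n m n) ⟩
    (m % n + k % n) % n          ≡⟨ %-distribˡ-+ m k n ⟨
    (m + k) % n                  ∎
    where
    open ≡-Reasoning

  [m+k%n]%n≡[m+k]%n : ∀ m k → (m + k % n) % n ≡ (m + k) % n
  [m+k%n]%n≡[m+k]%n m k = begin
    (m + k % n) % n   ≡⟨ cong (_% n) (ℕP.+-comm m (k % n)) ⟩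
    (k % n + m) % n   ≡⟨ [m%n+k]%n≡[m+k]%n k m ⟩
    (k + m) % n       ≡⟨ cong (_% n) (ℕP.+-comm k m) ⟩
    (m + k) % n       ∎
    where
    open ≡-Reasoning

  [m+k]%n≡m%n⇒n∣k : ∀ m k → (m + k) % n ≡ m % n → n ∣ k
  [m+k]%n≡m%n⇒n∣k m k same =
    ∣m+n∣m⇒∣n (divides ((m + k) / n) (trans (ℕP.+-comm (m / n * n) k) (ℕP.+-cancelʳ-≡ (m % n) _ _ eq))) (n∣m*n (m / n))
    where
    open ≡-Reasoning
    eq : k + m / n * n + m % n ≡ (m + k) / n * n + m % n
    eq = begin
      k + m / n * n + m % n          ≡⟨ ℕP.+-assoc k (m / n * n) (m % n) ⟩
      k + (m / n * n + m % n)        ≡⟨ cong (_+_ k) (ℕP.+-comm (m / n * n) (m % n)) ⟩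
      k + (m % n + m / n * n)        ≡⟨ cong (_+_ k) (m≡m%n+[m/n]*n m n) ⟨
      k + m                          ≡⟨ ℕP.+-comm k m ⟩
      m + k                          ≡⟨ m≡m%n+[m/n]*n (m + k) n ⟩
      (m + k) % n + (m + k) / n * n  ≡⟨ cong (_+ (m + k) / n * n) same ⟩
      m % n + (m + k) / n * n        ≡⟨ ℕP.+-comm (m % n) _ ⟩
      (m + k) / n * n + m % n        ∎

length-σ : ∀ w → length (σ w) ≡ length w
length-σ []      = refl
length-σ (x ∷ w) = trans (LP.length-++ w) (ℕP.+-comm (length w) 1)

length-σ^ : ∀ k w → length (σ^ k w) ≡ length w
length-σ^ zero    w = refl
length-σ^ (suc k) w = trans (length-σ (σ^ k w)) (length-σ^ k w)

coeff-σ : ∀ {p} .{{_ : NonZero p}} w {c} → length w ≡ p → c < p → coeff (σ w) c ≡ coeff w (suc c % p)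
coeff-σ (x ∷ w) {c} refl c<p with ℕP.m≤n⇒m<n∨m≡n (ℕP.≤-pred c<p)
... | inj₁ c<w = trans (coeff-++ˡ w (x ∷ []) c<w) (cong (coeff (x ∷ w)) (sym (m<n⇒m%n≡m (s≤s c<w))))
... | inj₂ refl = begin
  coeff (w ++ x ∷ []) (length w)       ≡⟨ cong (coeff (w ++ x ∷ [])) (sym (ℕP.+-identityʳ (length w))) ⟩
  coeff (w ++ x ∷ []) (length w + 0)   ≡⟨ coeff-++ʳ w (x ∷ []) 0 ⟩
  x                                    ≡⟨ cong (coeff (x ∷ w)) (n%n≡0 (suc (length w))) ⟨
  coeff (x ∷ w) (suc (length w) % suc (length w)) ∎
  where open ≡-Reasoning

coeff-σ^ : ∀ {p} .{{_ : NonZero p}} k w {c} → length w ≡ p → c < p → coeff (σ^ k w) c ≡ coeff w ((c + k) % p)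
coeff-σ^ {p} zero w {c} _ c<p = cong (coeff w) (sym (trans (cong (_% p) (ℕP.+-identityʳ c)) (m<n⇒m%n≡m c<p)))
coeff-σ^ {p} (suc k) w {c} w≡p c<p = begin
  coeff (σ (σ^ k w)) c              ≡⟨ coeff-σ (σ^ k w) (trans (length-σ^ k w) w≡p) c<p ⟩
  coeff (σ^ k w) (suc c % p)        ≡⟨ coeff-σ^ k w w≡p (m%n<n (suc c) p) ⟩
  coeff w ((suc c % p + k) % p)     ≡⟨ cong (coeff w) ([m%n+k]%n≡[m+k]%n p (suc c) k) ⟩
  coeff w ((suc c + k) % p)         ≡⟨ cong (λ m → coeff w (m % p)) (sym (ℕP.+-suc c k)) ⟩
  coeff w ((c + suc k) % p)         ∎
  where open ≡-Reasoning

δ : ℕ → ℤ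
δ 0             = + 1
δ 1             = -[1+ 0 ]
δ (suc (suc _)) = + 0

coeff-d₀ : ∀ p c → coeff (d₀ p) c ≡ δ c
coeff-d₀ p 0             = refl
coeff-d₀ p 1             = refl
coeff-d₀ p (suc (suc c)) = coeff-zeros (p ∸ 2) c

length-⊕ : ∀ u v → length u ≡ length v → length (u ⊕ v) ≡ length u
length-⊕ []      []      _ = refl
length-⊕ (x ∷ u) (y ∷ v) e = cong suc (length-⊕ u v (ℕP.suc-injective e))

coeff-⊕ : ∀ u v k → length u ≡ length v → coeff (u ⊕ v) k ≡ coeff u k ℤ.+ coeff v k
coeff-⊕ []      []      k       _ = refl
coeff-⊕ (x ∷ u) (y ∷ v) zero    _ = refl
coeff-⊕ (x ∷ u) (y ∷ v) (suc k) e = coeff-⊕ u v k (ℕP.suc-injective e)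

indicator : ∀ {A : Set} → Dec A → ℕ
indicator (yes _) = 1
indicator (no _)  = 0

indicator-yes : ∀ {A : Set} (a? : Dec A) → A → indicator a? ≡ 1
indicator-yes (yes _) _ = refl
indicator-yes (no ¬a) a = ⊥-elim (¬a a)

indicator-no : ∀ {A : Set} (a? : Dec A) → ¬ A → indicator a? ≡ 0
indicator-no (yes a) ¬a = ⊥-elim (¬a a)
indicator-no (no _)  _  = refl

indicator≤1 : ∀ {A : Set} (a? : Dec A) → indicator a? ≤ 1
indicator≤1 (yes _) = s≤s z≤n
indicator≤1 (no _)  = z≤n

δ≡indicator : ∀ r → δ r ≡ + indicator (r ≟ 0) ℤ.- + indicator (r ≟ 1)
δ≡indicator 0             = refl
δ≡indicator 1             = refl
δ≡indicator (suc (suc r)) = refl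

∑< : ℕ → (ℕ → ℕ) → ℕ
∑< zero    f = 0
∑< (suc n) f = ∑< n f + f n

∑<-+ : ∀ n f g → ∑< n (λ v → f v + g v) ≡ ∑< n f + ∑< n g
∑<-+ zero    f g = refl
∑<-+ (suc n) f g = trans (cong (_+ (f n + g n)) (∑<-+ n f g)) (swap (∑< n f) (∑< n g) (f n) (g n))
  where
  swap : ∀ a b c d → a + b + (c + d) ≡ a + c + (b + d)
  swap = ℕ-Solver.solve-∀

∑<-indicator-≡ : ∀ x n → x < n → ∑< n (λ v → indicator (x ≟ v)) ≡ 1
∑<-indicator-≢ : ∀ x n → n ≤ x → ∑< n (λ v → indicator (x ≟ v)) ≡ 0
∑<-indicator-≢ x zero    _   = refl
∑<-indicator-≢ x (suc n) n<x =
  cong₂ _+_ (∑<-indicator-≢ x n (ℕP.<⇒≤ n<x)) (indicator-no (x ≟ n) (λ x≡n → ℕP.<-irrefl (sym x≡n) n<x))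
∑<-indicator-≡ x (suc n) x<1+n with ℕP.<-≤-connex x n
... | inj₁ x<n = cong₂ _+_ (∑<-indicator-≡ x n x<n) (indicator-no (x ≟ n) (λ x≡n → ℕP.<-irrefl x≡n x<n))
... | inj₂ n≤x = cong₂ _+_ (∑<-indicator-≢ x n n≤x) (indicator-yes (x ≟ n) (ℕP.≤-antisym (ℕP.≤-pred x<1+n) n≤x))

∑<-≤ : ∀ n f → (∀ v → v < n → f v ≤ 1) → ∑< n f ≤ n
∑<-≤ zero    f _   = z≤n
∑<-≤ (suc n) f f≤1 = ℕP.≤-trans (ℕP.+-mono-≤ (∑<-≤ n f (λ v v<n → f≤1 v (ℕP.m<n⇒m<1+n v<n))) (f≤1 n ℕP.≤-refl))
                                 (ℕP.≤-reflexive (ℕP.+-comm n 1))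

∑<≡1+n⇒last≡1 : ∀ n f → (∀ v → v < suc n → f v ≤ 1) → ∑< (suc n) f ≡ suc n → f n ≡ 1
∑<≡1+n⇒last≡1 n f f≤1 ∑≡ = ℕP.≤-antisym (f≤1 n ℕP.≤-refl) (ℕP.+-cancelˡ-≤ n 1 (f n) (begin
  n + 1          ≡⟨ ℕP.+-comm n 1 ⟩
  suc n          ≡⟨ ∑≡ ⟨
  ∑< n f + f n   ≤⟨ ℕP.+-monoˡ-≤ (f n) (∑<-≤ n f (λ u u<n → f≤1 u (ℕP.m<n⇒m<1+n u<n))) ⟩
  n + f n        ∎))
  where open ℕP.≤-Reasoning

∑<≡n⇒≡1 : ∀ n f → (∀ v → v < n → f v ≤ 1) → ∑< n f ≡ n → ∀ v → v < n → f v ≡ 1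
∑<≡n⇒≡1 (suc n) f f≤1 ∑≡ v v<1+n with ℕP.<-≤-connex v n
... | inj₁ v<n = ∑<≡n⇒≡1 n f (λ u u<n → f≤1 u (ℕP.m<n⇒m<1+n u<n)) ∑n≡n v v<n
  where
  ∑n≡n : ∑< n f ≡ n
  ∑n≡n = ℕP.+-cancelʳ-≡ (f n) (∑< n f) n
           (trans ∑≡ (trans (ℕP.+-comm 1 n) (cong (_+_ n) (sym (∑<≡1+n⇒last≡1 n f f≤1 ∑≡)))))
... | inj₂ n≤v rewrite ℕP.≤-antisym (ℕP.≤-pred v<1+n) n≤v = ∑<≡1+n⇒last≡1 n f f≤1 ∑≡

module Words (a q : ℕ) where

  p : ℕ
  p = suc (suc a)

  -- D and Ω i are the p-periodic extensions of the coefficients of d₀ and of ω_i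
  D : ℕ → ℤ
  D k = δ (k % p)

  length-d₀ : length (d₀ p) ≡ p
  length-d₀ = cong (λ n → suc (suc n)) (LP.length-replicate a)

  length-dw : ∀ i → length (dw p q i) ≡ p
  length-dw i = trans (length-σ^ (i * q) (d₀ p)) length-d₀

  coeff-dw : ∀ i {c} → c < p → coeff (dw p q i) c ≡ D (c + i * q)
  coeff-dw i c<p = trans (coeff-σ^ (i * q) (d₀ p) length-d₀ c<p) (coeff-d₀ p _)

  Ω : ℕ → ℕ → ℤ
  Ω zero    c = D (c + 0 * q)
  Ω (suc i) c = Ω i c ℤ.+ D (c + suc i * q)

  length-ω : ∀ i → length (ω p q i) ≡ p
  length-ω zero    = length-d₀
  length-ω (suc i) = trans (length-⊕ (ω p q i) (dw p q (suc i)) (trans (length-ω i) (sym (length-dw (suc i))))) (length-ω i)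

  coeff-ω : ∀ i {c} → c < p → coeff (ω p q i) c ≡ Ω i c
  coeff-ω zero    c<p = coeff-dw 0 c<p
  coeff-ω (suc i) {c} c<p =
    trans (coeff-⊕ (ω p q i) (dw p q (suc i)) c (trans (length-ω i) (sym (length-dw (suc i)))))
          (cong₂ ℤ._+_ (coeff-ω i c<p) (coeff-dw (suc i) c<p))

  D-mod : ∀ c k → D (c % p + k) ≡ D (c + k)
  D-mod c k = cong δ ([m%n+k]%n≡[m+k]%n p c k)

  Ω-mod : ∀ i c → Ω i (c % p) ≡ Ω i c
  Ω-mod zero    c = D-mod c (0 * q)
  Ω-mod (suc i) c = cong₂ ℤ._+_ (Ω-mod i c) (D-mod c (suc i * q))

  hits : ℕ → ℕ → ℕ → ℕ
  hits v i c = ∑< (suc i) (λ l → indicator ((c + l * q) % p ≟ v))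

  Ω≡hits : ∀ i c → Ω i c ≡ + hits 0 i c ℤ.- + hits 1 i c
  Ω≡hits zero    c = δ≡indicator _
  Ω≡hits (suc i) c = begin
    Ω i c ℤ.+ D (c + suc i * q)
      ≡⟨ cong₂ ℤ._+_ (Ω≡hits i c) (δ≡indicator _) ⟩
    (+ hits 0 i c ℤ.- + hits 1 i c) ℤ.+ (+ h 0 ℤ.- + h 1)
      ≡⟨ regroup (+ hits 0 i c) (+ hits 1 i c) (+ h 0) (+ h 1) ⟩
    (+ hits 0 i c ℤ.+ + h 0) ℤ.- (+ hits 1 i c ℤ.+ + h 1)
      ≡⟨ cong₂ ℤ._-_ (ℤP.pos-+ (hits 0 i c) (h 0)) (ℤP.pos-+ (hits 1 i c) (h 1)) ⟨
    + hits 0 (suc i) c ℤ.- + hits 1 (suc i) c ∎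
    where
    open ≡-Reasoning
    h : ℕ → ℕ
    h v = indicator ((c + suc i * q) % p ≟ v)
    regroup : ∀ w x y z → (w ℤ.- x) ℤ.+ (y ℤ.- z) ≡ (w ℤ.+ y) ℤ.- (x ℤ.+ z)
    regroup = solve-∀

  module _ (p-prime : Prime p) (p∤q : ¬ p ∣ q) where

    residues-distinct : ∀ c {l l′} → l < l′ → l′ < p → (c + l * q) % p ≢ (c + l′ * q) % p
    residues-distinct c {l} l<l′ l′<p same with ℕP.m≤n⇒∃[o]m+o≡n l<l′
    ... | d , refl with euclidsLemma (suc d) q p-prime ([m+k]%n≡m%n⇒n∣k p (c + l * q) (suc d * q) (trans (cong (_% p) (regroup c l d q)) (sym same)))
      where
      regroup : ∀ c l d q → c + l * q + suc d * q ≡ c + (suc l + d) * q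
      regroup = ℕ-Solver.solve-∀
    ...   | inj₂ p∣q = p∤q p∣q
    ...   | inj₁ p∣1+d = ℕP.<-irrefl refl (ℕP.<-≤-trans (ℕP.≤-<-trans (s≤s (ℕP.m≤n+m d l)) l′<p) (∣⇒≤ p∣1+d))

    hits≡0 : ∀ v i c → (∀ l → l ≤ i → (c + l * q) % p ≢ v) → hits v i c ≡ 0
    hits≡0 v zero    c miss = indicator-no ((c + 0 * q) % p ≟ v) (miss 0 z≤n)
    hits≡0 v (suc i) c miss =
      cong₂ _+_ (hits≡0 v i c (λ l l≤i → miss l (ℕP.m≤n⇒m≤1+n l≤i))) (indicator-no ((c + suc i * q) % p ≟ v) (miss (suc i) ℕP.≤-refl))

    hits≤1 : ∀ v i c → i < p → hits v i c ≤ 1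
    hits≤1 v zero    c _   = indicator≤1 ((c + 0 * q) % p ≟ v)
    hits≤1 v (suc i) c i<p with (c + suc i * q) % p ≟ v
    ... | yes hit = ℕP.≤-reflexive (cong (_+ 1) (hits≡0 v i c (λ l l≤i same → residues-distinct c (s≤s l≤i) i<p (trans same (sym hit)))))
    ... | no _    = ℕP.≤-trans (ℕP.≤-reflexive (ℕP.+-identityʳ _)) (hits≤1 v i c (ℕP.<-trans (ℕP.n<1+n i) i<p))

    ∑-hits : ∀ i c → ∑< p (λ v → hits v i c) ≡ suc i
    ∑-hits zero    c = ∑<-indicator-≡ ((c + 0 * q) % p) p (m%n<n (c + 0 * q) p)
    ∑-hits (suc i) c = begin
      ∑< p (λ v → hits v i c + indicator (x ≟ v))          ≡⟨ ∑<-+ p (λ v → hits v i c) (λ v → indicator (x ≟ v)) ⟩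
      ∑< p (λ v → hits v i c) + ∑< p (λ v → indicator (x ≟ v)) ≡⟨ cong₂ _+_ (∑-hits i c) (∑<-indicator-≡ x p (m%n<n (c + suc i * q) p)) ⟩
      suc i + 1                                             ≡⟨ ℕP.+-comm (suc i) 1 ⟩
      suc (suc i)                                           ∎
      where
      open ≡-Reasoning
      x : ℕ
      x = (c + suc i * q) % p

    -- pigeonhole: the p residues c + l q (l < p) are distinct, so each residue occurs
    hits-full : ∀ v c → v < p → hits v (suc a) c ≡ 1
    hits-full v c = ∑<≡n⇒≡1 p (λ v → hits v (suc a) c) (λ v _ → hits≤1 v (suc a) c ℕP.≤-refl) (∑-hits (suc a) c) v

    Ω∈𝒜 : ∀ i c → i < p → In𝒜 (Ω i c)
    Ω∈𝒜 i c i<p = subst In𝒜 (sym (Ω≡hits i c)) (difference∈𝒜 (hits≤1 0 i c i<p) (hits≤1 1 i c i<p))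
      where
      difference∈𝒜 : ∀ {m n} → m ≤ 1 → n ≤ 1 → In𝒜 (+ m ℤ.- + n)
      difference∈𝒜 z≤n       z≤n       = inj₂ (inj₁ refl)
      difference∈𝒜 z≤n       (s≤s z≤n) = inj₁ refl
      difference∈𝒜 (s≤s z≤n) z≤n       = inj₂ (inj₂ refl)
      difference∈𝒜 (s≤s z≤n) (s≤s z≤n) = inj₂ (inj₁ refl)

    Ω-full : ∀ c → Ω (suc a) c ≡ + 0
    Ω-full c = trans (Ω≡hits (suc a) c) (cong₂ (λ m n → + m ℤ.- + n) (hits-full 0 c (s≤s z≤n)) (hits-full 1 c (s≤s (s≤s z≤n))))

    ω∈𝒜^ : ∀ i → i < p → In𝒜^ p (ω p q i)
    ω∈𝒜^ i i<p = length-ω i , all-coeffs (ω p q i) (λ c c<ω → subst In𝒜 (sym (coeff-ω i (subst (c <_) (length-ω i) c<ω))) (Ω∈𝒜 i c i<p))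
      where
      all-coeffs : ∀ {P : ℤ → Set} w → (∀ c → c < length w → P (coeff w c)) → All P w
      all-coeffs []      _ = []
      all-coeffs (x ∷ w) P = P 0 (s≤s z≤n) ∷ all-coeffs w (λ c c<w → P (suc c) (s≤s c<w))

module _ (a q q′ : ℕ) where
  open Words a q using (p; length-dw; coeff-dw)
  private module W′ = Words a q′

  dw-residue : q′ % p ≡ q % p → ∀ i → dw p q′ i ≡ dw p q i
  dw-residue q′≡q i = ≈∧length⇒≡ (trans (W′.length-dw i) (sym (length-dw i))) (mk≈ λ c → coefficient c)
    where
    same-residue : ∀ c → (c + i * q′) % p ≡ (c + i * q) % p
    same-residue c = begin
      (c + i * q′) % p                    ≡⟨ [m+k%n]%n≡[m+k]%n p c (i * q′) ⟨
      (c + (i * q′) % p) % p              ≡⟨ cong (λ r → (c + r) % p) (%-distribˡ-* i q′ p) ⟩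
      (c + (i % p * (q′ % p)) % p) % p    ≡⟨ cong (λ r → (c + (i % p * r) % p) % p) q′≡q ⟩
      (c + (i % p * (q % p)) % p) % p     ≡⟨ cong (λ r → (c + r) % p) (%-distribˡ-* i q p) ⟨
      (c + (i * q) % p) % p               ≡⟨ [m+k%n]%n≡[m+k]%n p c (i * q) ⟩
      (c + i * q) % p                     ∎
      where open ≡-Reasoning
    coefficient : ∀ c → coeff (dw p q′ i) c ≡ coeff (dw p q i) c
    coefficient c with ℕP.<-≤-connex c p
    ... | inj₁ c<p = trans (W′.coeff-dw i c<p) (trans (cong δ (same-residue c)) (sym (coeff-dw i c<p)))
    ... | inj₂ p≤c = trans (coeff-≥length (dw p q′ i) (subst (_≤ c) (sym (W′.length-dw i)) p≤c))
                           (sym (coeff-≥length (dw p q i) (subst (_≤ c) (sym (length-dw i)) p≤c)))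

  ω-residue : q′ % p ≡ q % p → ∀ i → ω p q′ i ≡ ω p q i
  ω-residue q′≡q zero    = refl
  ω-residue q′≡q (suc i) = cong₂ _⊕_ (ω-residue q′≡q i) (dw-residue q′≡q (suc i))

-- Fractional powers

length-take-≤ : ∀ n (xs : List ℤ) → n ≤ length xs → length (take n xs) ≡ n
length-take-≤ n xs n≤xs = trans (LP.length-take n xs) (ℕP.m≤n⇒m⊓n≡m n≤xs)

length-take≤ : ∀ n (xs : List ℤ) → length (take n xs) ≤ n
length-take≤ n xs = ℕP.≤-trans (ℕP.≤-reflexive (LP.length-take n xs)) (ℕP.m⊓n≤m n (length xs))

module _ {p : ℕ} .{{_ : NonZero p}} {v : List ℤ} (v≡p : length v ≡ p) where

  length-^ʷ : ∀ n → length (v ^ʷ n) ≡ n * p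
  length-^ʷ zero    = refl
  length-^ʷ (suc n) = trans (LP.length-++ v) (cong₂ _+_ v≡p (length-^ʷ n))

  coeff-^ʷ : ∀ n {t} → t < n * p → coeff (v ^ʷ n) t ≡ coeff v (t % p)
  coeff-^ʷ (suc n) {t} t<np with ℕP.<-≤-connex t p
  ... | inj₁ t<p = trans (coeff-++ˡ v (v ^ʷ n) (subst (t <_) (sym v≡p) t<p)) (cong (coeff v) (sym (m<n⇒m%n≡m t<p)))
  ... | inj₂ p≤t with ℕP.m≤n⇒∃[o]m+o≡n p≤t
  ...   | j , refl = begin
    coeff (v ++ v ^ʷ n) (p + j)          ≡⟨ cong (λ l → coeff (v ++ v ^ʷ n) (l + j)) v≡p ⟨
    coeff (v ++ v ^ʷ n) (length v + j)   ≡⟨ coeff-++ʳ v (v ^ʷ n) j ⟩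
    coeff (v ^ʷ n) j                     ≡⟨ coeff-^ʷ n (ℕP.+-cancelˡ-< p j (n * p) t<np) ⟩
    coeff v (j % p)                      ≡⟨ cong (coeff v) (trans (cong (_% p) (ℕP.+-comm p j)) ([m+n]%n≡m%n j p)) ⟨
    coeff v ((p + j) % p)                ∎
    where
    open ≡-Reasoning

  length-fpow : ∀ k → length (fpow p v k) ≡ k
  length-fpow k = begin
    length (v ^ʷ (k / p) ++ take (k % p) v)
      ≡⟨ LP.length-++ (v ^ʷ (k / p)) ⟩
    length (v ^ʷ (k / p)) + length (take (k % p) v)
      ≡⟨ cong₂ _+_ (length-^ʷ (k / p)) (length-take-≤ (k % p) v (subst (k % p ≤_) (sym v≡p) (m%n≤n k p))) ⟩
    k / p * p + k % p
      ≡⟨ ℕP.+-comm (k / p * p) (k % p) ⟩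
    k % p + k / p * p
      ≡⟨ m≡m%n+[m/n]*n k p ⟨
    k                                             ∎
    where
    open ≡-Reasoning

  coeff-fpow : ∀ k {t} → t < k → coeff (fpow p v k) t ≡ coeff v (t % p)
  coeff-fpow k {t} t<k with ℕP.<-≤-connex t (k / p * p)
  ... | inj₁ t<kp = trans (coeff-++ˡ (v ^ʷ (k / p)) _ (subst (t <_) (sym (length-^ʷ (k / p))) t<kp)) (coeff-^ʷ (k / p) t<kp)
  ... | inj₂ kp≤t with ℕP.m≤n⇒∃[o]m+o≡n kp≤t
  ...   | u , refl = begin
    coeff (v ^ʷ (k / p) ++ take (k % p) v) (k / p * p + u)
      ≡⟨ cong (λ l → coeff (v ^ʷ (k / p) ++ take (k % p) v) (l + u)) (length-^ʷ (k / p)) ⟨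
    coeff (v ^ʷ (k / p) ++ take (k % p) v) (length (v ^ʷ (k / p)) + u)
      ≡⟨ coeff-++ʳ (v ^ʷ (k / p)) (take (k % p) v) u ⟩
    coeff (take (k % p) v) u
      ≡⟨ coeff-take (k % p) v u<r ⟩
    coeff v u
      ≡⟨ cong (coeff v) (trans (cong (_% p) (ℕP.+-comm (k / p * p) u)) ([r+in]%n≡r p (k / p) (ℕP.<-trans u<r (m%n<n k p)))) ⟨
    coeff v ((k / p * p + u) % p)                                     ∎
    where
    open ≡-Reasoning
    u<r : u < k % p
    u<r = ℕP.+-cancelˡ-< (k / p * p) u (k % p) (subst (k / p * p + u <_) (trans (m≡m%n+[m/n]*n k p) (ℕP.+-comm (k % p) _)) t<k)

  take-fpow : ∀ {l k} → l ≤ k → take l (fpow p v k) ≡ fpow p v l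
  take-fpow {l} {k} l≤k = ≈∧length⇒≡ (trans (length-take-≤ l (fpow p v k) (subst (l ≤_) (sym (length-fpow k)) l≤k)) (sym (length-fpow l)))
    (mk≈ λ t → coefficient t)
    where
    coefficient : ∀ t → coeff (take l (fpow p v k)) t ≡ coeff (fpow p v l) t
    coefficient t with ℕP.<-≤-connex t l
    ... | inj₁ t<l = trans (coeff-take l (fpow p v k) t<l) (trans (coeff-fpow k (ℕP.<-≤-trans t<l l≤k)) (sym (coeff-fpow l t<l)))
    ... | inj₂ l≤t = trans (coeff-≥length (take l (fpow p v k)) (ℕP.≤-trans (length-take≤ l (fpow p v k)) l≤t))
                           (sym (coeff-≥length (fpow p v l) (subst (_≤ t) (sym (length-fpow l)) l≤t)))

^ʷ-++-fpow : ∀ {p} .{{_ : NonZero p}} v k → v ^ʷ (k / p) ++ fpow p v (k % p) ≡ fpow p v k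
^ʷ-++-fpow {p} v k = cong₂ (λ n r → v ^ʷ (k / p) ++ v ^ʷ n ++ take r v) (m<n⇒m/n≡0 (m%n<n k p)) (m%n%n≡m%n k p)

take-length-++ : ∀ (xs ys : List ℤ) n → take (length xs + n) (xs ++ ys) ≡ xs ++ take n ys
take-length-++ []       ys n = refl
take-length-++ (x ∷ xs) ys n = cong (x ∷_) (take-length-++ xs ys n)

take≈ : ∀ n u → (∀ {k} → n ≤ k → coeff u k ≡ + 0) → take n u ≈ u
take≈ n u tail = mk≈ λ k → coefficient k
  where
  coefficient : ∀ k → coeff (take n u) k ≡ coeff u k
  coefficient k with ℕP.<-≤-connex k n
  ... | inj₁ k<n = coeff-take n u k<n
  ... | inj₂ n≤k = trans (coeff-≥length (take n u) (ℕP.≤-trans (length-take≤ n u) n≤k)) (sym (tail n≤k))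

module Blocks (q : ℕ) (B : ℕ → List ℤ) (B≡q : ∀ i → length (B i) ≡ q) where

  concatMap-upTo-suc : ∀ n → concatMap B (upTo (suc n)) ≡ concatMap B (upTo n) ++ B n
  concatMap-upTo-suc n = begin
    concat (map B (upTo (suc n)))              ≡⟨ cong (concatMap B) (LP.applyUpTo-∷ʳ (λ i → i) n) ⟨
    concat (map B (upTo n ++ n ∷ []))          ≡⟨ cong concat (LP.map-++ B (upTo n) (n ∷ [])) ⟩
    concat (map B (upTo n) ++ B n ∷ [])        ≡⟨ LP.concat-++ (map B (upTo n)) (B n ∷ []) ⟨
    concatMap B (upTo n) ++ B n ++ []          ≡⟨ cong (concatMap B (upTo n) ++_) (LP.++-identityʳ (B n)) ⟩
    concatMap B (upTo n) ++ B n                ∎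
    where
    open ≡-Reasoning

  length-blocks : ∀ n → length (concatMap B (upTo n)) ≡ n * q
  length-blocks zero    = refl
  length-blocks (suc n) = begin
    length (concatMap B (upTo (suc n)))                 ≡⟨ cong length (concatMap-upTo-suc n) ⟩
    length (concatMap B (upTo n) ++ B n)                ≡⟨ LP.length-++ (concatMap B (upTo n)) ⟩
    length (concatMap B (upTo n)) + length (B n)        ≡⟨ cong₂ _+_ (length-blocks n) (B≡q n) ⟩
    n * q + q                                           ≡⟨ ℕP.+-comm (n * q) q ⟩
    suc n * q                                           ∎
    where
    open ≡-Reasoning

  coeff-blocks : ∀ n {i t} → i < n → t < q → coeff (concatMap B (upTo n)) (t + i * q) ≡ coeff (B i) t
  coeff-blocks (suc n) {i} {t} i<1+n t<q rewrite concatMap-upTo-suc n with ℕP.<-≤-connex i n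
  ... | inj₁ i<n = trans (coeff-++ˡ (concatMap B (upTo n)) (B n) (subst (t + i * q <_) (sym (length-blocks n)) bound)) (coeff-blocks n i<n t<q)
    where
    bound : t + i * q < n * q
    bound = ℕP.<-≤-trans (ℕP.+-monoˡ-< (i * q) t<q) (ℕP.*-monoˡ-≤ q i<n)
  ... | inj₂ n≤i with ℕP.≤-antisym (ℕP.≤-pred i<1+n) n≤i
  ...   | refl = begin
    coeff (concatMap B (upTo i) ++ B i) (t + i * q)
      ≡⟨ cong (coeff (concatMap B (upTo i) ++ B i)) (ℕP.+-comm t (i * q)) ⟩
    coeff (concatMap B (upTo i) ++ B i) (i * q + t)
      ≡⟨ cong (λ l → coeff (concatMap B (upTo i) ++ B i) (l + t)) (length-blocks i) ⟨
    coeff (concatMap B (upTo i) ++ B i) (length (concatMap B (upTo i)) + t)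
      ≡⟨ coeff-++ʳ (concatMap B (upTo i)) (B i) t ⟩
    coeff (B i) t                                                            ∎
    where
    open ≡-Reasoning

-- The polynomial identity

module _ (a : ℕ) where
  private
    p : ℕ
    p = suc (suc a)

  neg-d₀≈x-1 : neg (d₀ p) ≈ xn-1 1
  neg-d₀≈x-1 = mk≈ λ { 0 → refl ; 1 → refl ; (suc (suc k)) → trans (coeff-scale -[1+ 0 ] (d₀ p) (suc (suc k))) (cong (-[1+ 0 ] ℤ.*_) (coeff-d₀ p (suc (suc k)))) }

  -- each block contributes -(1 - x)(1 + x + ⋯ + x^{p-1}) x^{ip} = x^{(i+1)p} - x^{ip}
  pmul-neg-d₀^ʷ-ones : ∀ n → pmul (neg (d₀ p ^ʷ n)) (ones p) ≈ x^[ n * p ]-1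
  pmul-neg-d₀^ʷ-ones zero    = mk≈ λ { zero → refl ; (suc k) → refl }
  pmul-neg-d₀^ʷ-ones (suc n) = begin
    pmul (neg (d₀ p ++ d₀ p ^ʷ n)) (ones p)
      ≡⟨ cong (λ u → pmul u (ones p)) (LP.map-++ (-[1+ 0 ] ℤ.*_) (d₀ p) (d₀ p ^ʷ n)) ⟩
    pmul (neg (d₀ p) ++ neg (d₀ p ^ʷ n)) (ones p)
      ≈⟨ pmul-++ˡ (neg (d₀ p)) (neg (d₀ p ^ʷ n)) (ones p) ⟩
    padd (pmul (neg (d₀ p)) (ones p)) (shift (length (neg (d₀ p))) (pmul (neg (d₀ p ^ʷ n)) (ones p)))
      ≈⟨ padd-cong first (≈-trans (≡⇒≈ (cong (λ l → shift l (pmul (neg (d₀ p ^ʷ n)) (ones p))) length-neg-d₀))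
                                  (shift-cong p (pmul-neg-d₀^ʷ-ones n))) ⟩
    padd x^[ p ]-1 (shift p x^[ n * p ]-1)
      ≈⟨ x^[+]-1 p (n * p) ⟩
    x^[ p + n * p ]-1 ∎
    where
    open import Relation.Binary.Reasoning.Setoid ≈-setoid
    length-neg-d₀ : length (neg (d₀ p)) ≡ p
    length-neg-d₀ = trans (LP.length-map (-[1+ 0 ] ℤ.*_) (d₀ p)) (cong (λ n → suc (suc n)) (LP.length-replicate a))
    first : pmul (neg (d₀ p)) (ones p) ≈ x^[ p ]-1
    first = ≈-trans (pmul-congˡ (ones p) neg-d₀≈x-1)
           (≈-trans (pmul-comm (xn-1 1) (ones p)) (≡⇒≈ (pmul-ones-x-1 (suc a))))

-- p = a + 2 and q = b + 1
module Identity (a b : ℕ) (p-prime : Prime (suc (suc a))) (p∤q : ¬ suc (suc a) ∣ suc b) where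
  open Words a (suc b) public

  q : ℕ
  q = suc b

  N : ℕ
  N = suc a * q

  -- coefficient k of ω₀^{q/p} ω₁^{q/p} ω₂^{q/p} ⋯
  V : ℕ → ℤ
  V k = Ω (k / q) (k % q)

  W : List ℤ
  W = applyUpTo V N

  V-block : ∀ i {t} → t < q → V (t + i * q) ≡ Ω i t
  V-block i t<q = cong₂ Ω ([r+in]/n≡i q i t<q) ([r+in]%n≡r q i t<q)

  V-start : ∀ {k} → k < q → V k ≡ D k
  V-start {k} k<q = begin
    V k                 ≡⟨ cong V (ℕP.+-identityʳ k) ⟨
    V (k + 0 * q)       ≡⟨ V-block 0 k<q ⟩
    D (k + 0 * q)       ≡⟨ cong D (ℕP.+-identityʳ k) ⟩
    D k                 ∎
    where
    open ≡-Reasoning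

  V-step : ∀ k → V (q + k) ≡ V k ℤ.+ D (q + k)
  V-step k = begin
    V (q + k)                                ≡⟨ cong V next ⟩
    V (k % q + suc (k / q) * q)              ≡⟨ V-block (suc (k / q)) (m%n<n k q) ⟩
    Ω (k / q) (k % q) ℤ.+ D (k % q + suc (k / q) * q) ≡⟨ cong (ℤ._+_ (V k)) (cong D next) ⟨
    V k ℤ.+ D (q + k)                        ∎
    where
    open ≡-Reasoning
    next : q + k ≡ k % q + suc (k / q) * q
    next = trans (cong (_+_ q) (m≡m%n+[m/n]*n k q)) (swap q (k % q) (k / q * q))
      where
      swap : ∀ x y z → x + (y + z) ≡ y + (x + z)
      swap = ℕ-Solver.solve-∀

  V-full : ∀ {t} → t < q → V (t + suc a * q) ≡ + 0
  V-full {t} t<q = trans (V-block (suc a) t<q) (Ω-full p-prime p∤q t)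

  V-beyond : ∀ {j} → N ≤ q + j → j < N → V (q + j) ≡ + 0
  V-beyond {j} N≤q+j j<N with ℕP.m≤n⇒∃[o]m+o≡n N≤q+j
  ... | t , N+t≡q+j = trans (cong V (trans (sym N+t≡q+j) (ℕP.+-comm N t))) (V-full t<q)
    where
    t<q : t < q
    t<q = ℕP.+-cancelˡ-< N t q (subst (_< N + q) (sym N+t≡q+j) (subst (q + j <_) (ℕP.+-comm q N) (ℕP.+-monoʳ-< q j<N)))

  D-periodic : ∀ {k} → k < q * p → coeff (d₀ p ^ʷ q) k ≡ D k
  D-periodic {k} k<qp = trans (coeff-^ʷ length-d₀ q k<qp) (coeff-d₀ p (k % p))

  D-beyond : ∀ {k} → q * p ≤ k → coeff (d₀ p ^ʷ q) k ≡ + 0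
  D-beyond {k} qp≤k = coeff-≥length (d₀ p ^ʷ q) (subst (_≤ k) (sym (length-^ʷ {v = d₀ p} length-d₀ q)) qp≤k)

  coeff-W-< : ∀ {k} → k < N → coeff W k ≡ V k
  coeff-W-< = coeff-applyUpTo V

  coeff-W-≥ : ∀ {k} → N ≤ k → coeff W k ≡ + 0
  coeff-W-≥ = coeff-applyUpTo-≥ V

  q≤N : q ≤ N
  q≤N = ℕP.m≤m+n q (a * q)

  qp≡q+N : q * p ≡ q + N
  qp≡q+N = ℕP.*-comm q p

  xq-1-W-below : ∀ {k} → k < q → coeff (shift q W) k ℤ.- coeff W k ≡ -[1+ 0 ] ℤ.* coeff (d₀ p ^ʷ q) k
  xq-1-W-below {k} k<q = begin
    coeff (shift q W) k ℤ.- coeff W k    ≡⟨ cong₂ ℤ._-_ (coeff-shift-< q W k<q) (trans (coeff-W-< (ℕP.<-≤-trans k<q q≤N)) (V-start k<q)) ⟩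
    + 0 ℤ.- D k                          ≡⟨ negate (D k) ⟩
    -[1+ 0 ] ℤ.* D k                     ≡⟨ cong (-[1+ 0 ] ℤ.*_) (D-periodic (ℕP.<-≤-trans k<q (ℕP.m≤m*n q p))) ⟨
    -[1+ 0 ] ℤ.* coeff (d₀ p ^ʷ q) k     ∎
    where
    open ≡-Reasoning
    negate : ∀ x → + 0 ℤ.- x ≡ -[1+ 0 ] ℤ.* x
    negate = solve-∀

  xq-1-W-inside : ∀ {j} → q + j < N → coeff (shift q W) (q + j) ℤ.- coeff W (q + j) ≡ -[1+ 0 ] ℤ.* coeff (d₀ p ^ʷ q) (q + j)
  xq-1-W-inside {j} q+j<N = begin
    coeff (shift q W) (q + j) ℤ.- coeff W (q + j)
      ≡⟨ cong₂ ℤ._-_ (trans (coeff-shift-+ q W j) (coeff-W-< j<N)) (trans (coeff-W-< q+j<N) (V-step j)) ⟩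
    V j ℤ.- (V j ℤ.+ D (q + j))
      ≡⟨ cancel (V j) (D (q + j)) ⟩
    -[1+ 0 ] ℤ.* D (q + j)
      ≡⟨ cong (-[1+ 0 ] ℤ.*_) (D-periodic (ℕP.<-≤-trans q+j<N (subst (N ≤_) (sym qp≡q+N) (ℕP.m≤n+m N q)))) ⟨
    -[1+ 0 ] ℤ.* coeff (d₀ p ^ʷ q) (q + j) ∎
    where
    open ≡-Reasoning
    j<N : j < N
    j<N = ℕP.≤-<-trans (ℕP.m≤n+m j q) q+j<N
    cancel : ∀ x y → x ℤ.- (x ℤ.+ y) ≡ -[1+ 0 ] ℤ.* y
    cancel = solve-∀

  -- the last block drops out because ω_{p-2} + d_{p-1} = ω_{p-1} = 0
  xq-1-W-top : ∀ {j} → j < N → N ≤ q + j → coeff (shift q W) (q + j) ℤ.- coeff W (q + j) ≡ -[1+ 0 ] ℤ.* coeff (d₀ p ^ʷ q) (q + j)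
  xq-1-W-top {j} j<N N≤q+j = begin
    coeff (shift q W) (q + j) ℤ.- coeff W (q + j)
      ≡⟨ cong₂ ℤ._-_ (trans (coeff-shift-+ q W j) (coeff-W-< j<N)) (coeff-W-≥ N≤q+j) ⟩
    V j ℤ.- + 0
      ≡⟨ vanishing (V j) (D (q + j)) (trans (sym (V-step j)) (V-beyond N≤q+j j<N)) ⟩
    -[1+ 0 ] ℤ.* D (q + j)
      ≡⟨ cong (-[1+ 0 ] ℤ.*_) (D-periodic (subst (q + j <_) (sym qp≡q+N) (ℕP.+-monoʳ-< q j<N))) ⟨
    -[1+ 0 ] ℤ.* coeff (d₀ p ^ʷ q) (q + j) ∎
    where
    open ≡-Reasoning
    vanishing : ∀ x y → x ℤ.+ y ≡ + 0 → x ℤ.- + 0 ≡ -[1+ 0 ] ℤ.* y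
    vanishing x y x+y≡0 = trans (regroup x y) (trans (cong (ℤ._+_ (-[1+ 0 ] ℤ.* y)) x+y≡0) (ℤP.+-identityʳ _))
      where
      regroup : ∀ x y → x ℤ.- + 0 ≡ -[1+ 0 ] ℤ.* y ℤ.+ (x ℤ.+ y)
      regroup = solve-∀

  xq-1-W-above : ∀ {j} → N ≤ j → coeff (shift q W) (q + j) ℤ.- coeff W (q + j) ≡ -[1+ 0 ] ℤ.* coeff (d₀ p ^ʷ q) (q + j)
  xq-1-W-above {j} N≤j = begin
    coeff (shift q W) (q + j) ℤ.- coeff W (q + j)
      ≡⟨ cong₂ ℤ._-_ (trans (coeff-shift-+ q W j) (coeff-W-≥ N≤j)) (coeff-W-≥ (ℕP.≤-trans N≤j (ℕP.m≤n+m j q))) ⟩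
    + 0
      ≡⟨ ℤP.*-zeroʳ -[1+ 0 ] ⟨
    -[1+ 0 ] ℤ.* + 0
      ≡⟨ cong (-[1+ 0 ] ℤ.*_) (D-beyond (subst (_≤ q + j) (sym qp≡q+N) (ℕP.+-monoʳ-≤ q N≤j))) ⟨
    -[1+ 0 ] ℤ.* coeff (d₀ p ^ʷ q) (q + j) ∎
    where open ≡-Reasoning

  -- the recursion ω_{i+1} = ω_i + d_{i+1} in polynomial form
  pmul-xq-1-W : pmul (xn-1 q) W ≈ neg (d₀ p ^ʷ q)
  pmul-xq-1-W = mk≈ λ k → trans (coeff-pmul-xn-1 b W k) (trans (case k) (sym (coeff-scale -[1+ 0 ] (d₀ p ^ʷ q) k)))
    where
    case : ∀ k → coeff (shift q W) k ℤ.- coeff W k ≡ -[1+ 0 ] ℤ.* coeff (d₀ p ^ʷ q) k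
    case k with ℕP.<-≤-connex k q
    ... | inj₁ k<q = xq-1-W-below k<q
    ... | inj₂ q≤k with ℕP.m≤n⇒∃[o]m+o≡n q≤k
    ...   | j , refl with ℕP.<-≤-connex (q + j) N | ℕP.<-≤-connex j N
    ...     | inj₁ q+j<N | _         = xq-1-W-inside q+j<N
    ...     | inj₂ N≤q+j | inj₁ j<N  = xq-1-W-top j<N N≤q+j
    ...     | inj₂ _     | inj₂ N≤j  = xq-1-W-above N≤j

  pmul-W-Φ₁ΦₚΦq : pmul W (Φ₁ΦₚΦq p q) ≈ xn-1 (p * q)
  pmul-W-Φ₁ΦₚΦq = begin
    pmul W (pmul X (pmul Op (pmul Oq (+ 1 ∷ []))))
      ≈⟨ pmul-congʳ W (pmul-congʳ X (pmul-congʳ Op (≈-trans (pmul-comm Oq (+ 1 ∷ [])) (pmul-identityˡ Oq)))) ⟩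
    pmul W (pmul X (pmul Op Oq))
      ≈⟨ pmul-congʳ W (pmul-congʳ X (pmul-comm Op Oq)) ⟩
    pmul W (pmul X (pmul Oq Op))
      ≈⟨ pmul-congʳ W (pmul-assoc X Oq Op) ⟨
    pmul W (pmul (pmul X Oq) Op)
      ≈⟨ pmul-congʳ W (pmul-congˡ Op (≈-trans (pmul-comm X Oq) (≡⇒≈ (pmul-ones-x-1 b)))) ⟩
    pmul W (pmul (xn-1 q) Op)
      ≈⟨ pmul-assoc W (xn-1 q) Op ⟨
    pmul (pmul W (xn-1 q)) Op
      ≈⟨ pmul-congˡ Op (≈-trans (pmul-comm W (xn-1 q)) pmul-xq-1-W) ⟩
    pmul (neg (d₀ p ^ʷ q)) Op
      ≈⟨ pmul-neg-d₀^ʷ-ones a q ⟩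
    x^[ q * p ]-1
      ≡⟨ cong x^[_]-1 (ℕP.*-comm q p) ⟩
    xn-1 (p * q) ∎
    where
    open import Relation.Binary.Reasoning.Setoid ≈-setoid
    X Op Oq : List ℤ
    X = xn-1 1
    Op = ones p
    Oq = ones q

-- p = a + 2 and q = a + c + 3; m = (p - 1)(q - 1), and L = q - p + 2 is the length of the last block
module Fractional (a c : ℕ) (p-prime : Prime (suc (suc a))) (p∤q : ¬ suc (suc a) ∣ suc (suc (suc (a + c)))) where

  b : ℕ
  b = suc (suc (a + c))

  open Identity a b p-prime p∤q

  m : ℕ
  m = suc a * b

  L : ℕ
  L = q ∸ p + 2

  block : ℕ → List ℤ
  block i = fpow p (ω p q i) q

  coeff-fpow-ω : ∀ i k {t} → t < k → coeff (fpow p (ω p q i) k) t ≡ Ω i t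
  coeff-fpow-ω i k {t} t<k = begin
    coeff (fpow p (ω p q i) k) t   ≡⟨ coeff-fpow (length-ω i) k t<k ⟩
    coeff (ω p q i) (t % p)        ≡⟨ coeff-ω i (m%n<n t p) ⟩
    Ω i (t % p)                    ≡⟨ Ω-mod i t ⟩
    Ω i t                          ∎
    where
    open ≡-Reasoning

  open Blocks q block (λ i → length-fpow (length-ω i) q)

  bWord≡blocks : bWord p q ≡ concatMap block (upTo (suc a))
  bWord≡blocks = LP.concatMap-cong (λ i → ^ʷ-++-fpow {p} (ω p q i) q) (upTo (suc a))

  blocks≡W : concatMap block (upTo (suc a)) ≡ W
  blocks≡W = ≈∧length⇒≡ (trans (length-blocks (suc a)) (sym (LP.length-applyUpTo V N))) (mk≈ coefficient)
    where
    coefficient : ∀ k → coeff (concatMap block (upTo (suc a))) k ≡ coeff W k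
    coefficient k with ℕP.<-≤-connex k N
    ... | inj₂ N≤k = trans (coeff-≥length (concatMap block (upTo (suc a))) (subst (_≤ k) (sym (length-blocks (suc a))) N≤k)) (sym (coeff-W-≥ N≤k))
    ... | inj₁ k<N = begin
      coeff (concatMap block (upTo (suc a))) k                 ≡⟨ cong (coeff (concatMap block (upTo (suc a)))) k≡ ⟩
      coeff (concatMap block (upTo (suc a))) (k % q + k / q * q) ≡⟨ coeff-blocks (suc a) (m<n*o⇒m/o<n {k} {suc a} {q} k<N) (m%n<n k q) ⟩
      coeff (block (k / q)) (k % q)                            ≡⟨ coeff-fpow-ω (k / q) q (m%n<n k q) ⟩
      V k                                                      ≡⟨ coeff-W-< k<N ⟨
      coeff W k                                                ∎
      where
      open ≡-Reasoning
      k≡ : k ≡ k % q + k / q * q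
      k≡ = m≡m%n+[m/n]*n k q

  L≡ : L ≡ suc c + 2
  L≡ = cong (_+ 2) (trans (cong (_∸ a) (sym (ℕP.+-suc a c))) (ℕP.m+n∸m≡n a (suc c)))

  1+m≡aq+L : suc m ≡ a * q + L
  1+m≡aq+L = trans (arith a c) (cong (_+_ (a * q)) (sym L≡))
    where
    arith : ∀ a c → suc (suc a * suc (suc (a + c))) ≡ a * suc (suc (suc (a + c))) + (suc c + 2)
    arith = ℕ-Solver.solve-∀

  m<N : m < N
  m<N = ℕP.*-monoʳ-< (suc a) (ℕP.n<1+n (suc (suc (a + c))))

  fracWord≡take-bWord : fracWord p q ≡ take (suc m) (bWord p q)
  fracWord≡take-bWord = sym (begin
    take (suc m) (bWord p q)
      ≡⟨ cong (take (suc m)) (trans bWord≡blocks (concatMap-upTo-suc a)) ⟩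
    take (suc m) (blocks ++ block a)
      ≡⟨ cong (λ n → take n (blocks ++ block a)) (trans 1+m≡aq+L (cong (_+ L) (sym (length-blocks a)))) ⟩
    take (length blocks + L) (blocks ++ block a)
      ≡⟨ take-length-++ blocks (block a) L ⟩
    blocks ++ take L (block a)
      ≡⟨ cong (blocks ++_) (take-fpow (length-ω a) L≤q) ⟩
    blocks ++ fpow p (ω p q a) L                                    ∎)
    where
    open ≡-Reasoning
    blocks : List ℤ
    blocks = concatMap block (upTo a)
    L≤q : L ≤ q
    L≤q = subst (_≤ q) (sym L≡) (s≤s (subst (_≤ suc (suc (a + c))) (ℕP.+-comm 2 c) (ℕP.+-monoʳ-≤ 2 (ℕP.m≤n+m c a))))

  -- beyond degree m the block recursion reaches a residue c + l q ∈ [2, p) where d vanishes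
  V-tail : ∀ {k} → m < k → k < N → V k ≡ + 0
  V-tail {k} m<k k<N with ℕP.m≤n⇒∃[o]m+o≡n m<k
  ... | s , refl = begin
    V k                       ≡⟨ ℤP.+-identityʳ (V k) ⟨
    V k ℤ.+ + 0               ≡⟨ cong (ℤ._+_ (V k)) D[q+k]≡0 ⟨
    V k ℤ.+ D (q + k)         ≡⟨ V-step k ⟨
    V (q + k)                 ≡⟨ V-beyond N≤q+k k<N ⟩
    + 0                       ∎
    where
    open ≡-Reasoning
    q+k≡ : q + k ≡ 2 + s + b * p
    q+k≡ = arith a c s
      where
      arith : ∀ a c s → suc (suc (suc (a + c))) + (suc (suc a * suc (suc (a + c))) + s) ≡ 2 + s + suc (suc (a + c)) * suc (suc a)
      arith = ℕ-Solver.solve-∀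
    N≤q+k : N ≤ q + k
    N≤q+k = subst (N ≤_) (arith a c s) (ℕP.m≤m+n N (3 + c + s))
      where
      arith : ∀ a c s → suc a * suc (suc (suc (a + c))) + (3 + c + s) ≡ suc (suc (suc (a + c))) + (suc (suc a * suc (suc (a + c))) + s)
      arith = ℕ-Solver.solve-∀
    2+s<p : 2 + s < p
    2+s<p = ℕP.+-cancelʳ-< (b * p) (2 + s) p (subst (_< p + b * p) q+k≡ (subst (q + k <_) (ℕP.*-comm p q) (ℕP.+-monoʳ-< q k<N)))
    D[q+k]≡0 : D (q + k) ≡ + 0
    D[q+k]≡0 = begin
      D (q + k)                        ≡⟨ cong D q+k≡ ⟩
      δ ((2 + s + b * p) % p)          ≡⟨ cong δ ([r+in]%n≡r p b 2+s<p) ⟩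
      δ (2 + s)                        ∎

  bWord≡W : bWord p q ≡ W
  bWord≡W = trans bWord≡blocks blocks≡W

  fracWord≈W : fracWord p q ≈ W
  fracWord≈W = ≈-trans (≡⇒≈ (trans fracWord≡take-bWord (cong (take (suc m)) bWord≡W))) (take≈ (suc m) W tail)
    where
    tail : ∀ {k} → suc m ≤ k → coeff W k ≡ + 0
    tail {k} m<k with ℕP.<-≤-connex k N
    ... | inj₁ k<N = trans (coeff-W-< k<N) (V-tail m<k k<N)
    ... | inj₂ N≤k = coeff-W-≥ N≤k

  length-fracWord : length (fracWord p q) ≡ suc m
  length-fracWord = trans (cong length fracWord≡take-bWord)
                          (length-take-≤ (suc m) (bWord p q) (subst (suc m ≤_) (sym (trans (cong length bWord≡W) (LP.length-applyUpTo V N))) m<N))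

  xn-1≡fracWord*Φ₁ΦₚΦq : xn-1 (p * q) ≡ pmul (fracWord p q) (Φ₁ΦₚΦq p q)
  xn-1≡fracWord*Φ₁ΦₚΦq = ≈∧length⇒≡ lengths (≈-sym (≈-trans (pmul-congˡ _ fracWord≈W) pmul-W-Φ₁ΦₚΦq))
    where
    length-Φ₁ΦₚΦq : length (Φ₁ΦₚΦq p q) ≡ suc (1 + (suc a + (b + 0)))
    length-Φ₁ΦₚΦq = length-pmul (xn-1 1) (pmul (ones p) (pmul (ones q) (+ 1 ∷ []))) refl
                 (length-pmul (ones p) (pmul (ones q) (+ 1 ∷ [])) (LP.length-replicate p)
                   (length-pmul (ones q) (+ 1 ∷ []) (LP.length-replicate q) refl))
    lengths : length (xn-1 (p * q)) ≡ length (pmul (fracWord p q) (Φ₁ΦₚΦq p q))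
    lengths = begin
      length (xn-1 (p * q))                              ≡⟨ length-xn-1 (b + suc a * q) ⟩
      suc (suc (b + suc a * q))                          ≡⟨ arith a c ⟩
      suc (m + (1 + (suc a + (b + 0))))                  ≡⟨ length-pmul (fracWord p q) _ length-fracWord length-Φ₁ΦₚΦq ⟨
      length (pmul (fracWord p q) (Φ₁ΦₚΦq p q)) ∎
      where
      open ≡-Reasoning
      arith : ∀ a c → suc (suc (suc (suc (a + c)) + suc a * suc (suc (suc (a + c)))))
                    ≡ suc (suc a * suc (suc (a + c)) + (1 + (suc a + (suc (suc (a + c)) + 0))))
      arith = ℕ-Solver.solve-∀

  cycloWord≡fracWord : Prime q → cycloWord p q ≡ fracWord p q
  cycloWord≡fracWord q-prime = begin
    cycloWord p q                                         ≡⟨ cycloWord-pq p-prime q-prime p<q ⟩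
    pdiv (xn-1 (p * q)) (Φ₁ΦₚΦq p q)                      ≡⟨ cong (λ f → pdiv f (Φ₁ΦₚΦq p q)) xn-1≡fracWord*Φ₁ΦₚΦq ⟩
    pdiv (pmul (fracWord p q) (Φ₁ΦₚΦq p q)) (Φ₁ΦₚΦq p q)  ≡⟨ pdiv-pmul (fracWord p q) (Φ₁ΦₚΦq p q) 1≤length (Φ₁ΦₚΦq-monic (suc a) b) ⟩
    fracWord p q                                          ∎
    where
    open ≡-Reasoning
    p<q : p < q
    p<q = s≤s (s≤s (s≤s (ℕP.m≤m+n a c)))
    1≤length : 1 ≤ length (fracWord p q)
    1≤length = subst (1 ≤_) (sym length-fracWord) (s≤s z≤n)

theorem1 : (p q : ℕ) .{{_ : NonZero p}} → Prime p → Prime q → p < q →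
    ((i : ℕ) → i ≤ p ∸ 2 → In𝒜^ p (ω p q i))
    × ((q′ : ℕ) → Prime q′ → p < q′ → q′ % p ≡ q % p →
         (i : ℕ) → i ≤ p ∸ 2 → ω p q′ i ≡ ω p q i)
    × (cycloWord p q ≡ take (suc ((p ∸ 1) * (q ∸ 1))) (bWord p q))
    × (cycloWord p q ≡ fracWord p q)
theorem1 p q p-prime q-prime p<q with prime⇒≡2+ p-prime | ℕP.m≤n⇒∃[o]m+o≡n p<q
... | a , refl | c , refl =
  (λ i i≤a → ω∈𝒜^ p-prime p∤q i (s≤s (ℕP.m≤n⇒m≤1+n i≤a))) ,
  (λ q′ _ _ q′≡q i _ → ω-residue a q q′ q′≡q i) ,
  trans (cycloWord≡fracWord q-prime) fracWord≡take-bWord ,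
  cycloWord≡fracWord q-prime
  where
  p∤q : ¬ p ∣ q
  p∤q = ∤-prime q-prime (s≤s (s≤s z≤n)) p<q
  open Words a q using (ω∈𝒜^)
  open Fractional a c p-prime p∤q
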